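{- Let $j\geq 1$ and $m\geq 1$ be integers. Let $G_m$ be the multigraph obtained from the cycle $v_0v_1\ldots v_mv_0$ by adding, for each $h=1,\dots,j$, a triangle $x_hy_hu_h$ on three new vertices together with an edge $u_hv_0$. Then $G_m$ is $(0,j)$-critical.
   Context: Multigraphs are finite without loops (for $m=1$ the cycle $v_0v_1v_0$ is a pair of parallel edges). A 2-fold cover of a multigraph $G$ is a pair $(L,\mathcal H)$ where $\mathcal H$ is a graph and $L$ assigns to each $v\in V(G)$ a 2-element set $L(v)=\{p(v),r(v)\}$ ($p(v)$ poor, $r(v)$ rich) such that the sets $L(v)$ partition $V(\mathcal H)$, $p(v)r(v)\in E(\mathcal H)$, edges of $\mathcal H$ between $L(u)$ and $L(v)$ ($u\ne v$) exist only if $uv\in E(G)$, and if $u,v$ are joined by $k\ge1$ edges then $\mathcal H[L(u),L(v)]$ is a union of at most $k$ perfect matchings between $L(u)$ and $L(v)$. An $\mathcal H$-map is a function $\phi$ with $\phi(v)\in L(v)$; $\mathcal H_\phi$ is the subgraph induced by $\phi(V(G))$. A $(0,j)$-coloring is an $\mathcal H$-map $\phi$ in which poor vertices of $\mathcal H_\phi$ have degree $0$ and rich ones degree at most $j$ in $\mathcal H_\phi$. $G$ is $(0,j)$-critical if some 2-fold cover of $G$ has no $(0,j)$-coloring while every 2-fold cover of each proper subgraph of $G$ has one. -}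

module Defs where

open import Data.Nat using (ℕ; zero; suc; _+_; _*_; _≤_; _≡ᵇ_)
open import Data.Nat.Properties using (+-comm)
open import Data.Fin as F using (Fin; toℕ; splitAt; quotRem)
open import Data.Bool using (Bool; true; false; if_then_else_; _∧_; _∨_; not)
open import Data.List using (List; length; map; allFin)
open import Data.Nat.ListAction using (sum)
open import Data.List.Relation.Unary.Any using (Any)
open import Data.Product using (Σ; _×_; _,_; ∃; proj₁; proj₂)
open import Data.Sum using (_⊎_; inj₁; inj₂)
open import Relation.Nullary using (¬_; yes; no; does)
open import Relation.Binary.PropositionalEquality using (_≡_; _≢_; refl; sym)
open import Function.Definitions using (Injective; Surjective)
open import Function.Bundles using (_⇔_)

record Multigraph : Set where
  field
    n        : ℕ
    mult     : Fin n → Fin n → ℕ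
    mult-sym : ∀ u v → mult u v ≡ mult v u
    loopless : ∀ v → mult v v ≡ 0
open Multigraph public

-- 2-fold covers.  V(𝓗) = Fin n × Bool, with L(v) = {(v,false),(v,true)},
-- p(v) = (v , false) poor, r(v) = (v , true) rich.  𝓗 is a (simple) graph
-- given by a Boolean adjacency relation.

CV : ℕ → Set
CV n = Fin n × Bool

-- a perfect matching between L(u) and L(v): a bijection Bool → Bool,
-- matching (u,a) with (v,σ a)
PerfectMatching : Set
PerfectMatching = Σ (Bool → Bool) (λ σ → Injective _≡_ _≡_ σ)

record TwoFoldCover (G : Multigraph) : Set where
  field
    adj     : CV (n G) → CV (n G) → Bool
    adj-sym : ∀ x y → adj x y ≡ adj y x
    adj-irr : ∀ x → adj x x ≡ false
    adj-pr  : ∀ v → adj (v , false) (v , true) ≡ true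
    adj-matchings : ∀ u v → u ≢ v →
      Σ (List PerfectMatching) λ Ms →
        (length Ms ≤ mult G u v) ×
        (∀ a b → (adj (u , a) (v , b) ≡ true) ⇔ Any (λ σ → proj₁ σ a ≡ b) Ms)
open TwoFoldCover public

-- an 𝓗-map: φ v = false means φ(v) = p(v), φ v = true means φ(v) = r(v)
HMap : Multigraph → Set
HMap G = Fin (n G) → Bool

degφ : {G : Multigraph} (C : TwoFoldCover G) (φ : HMap G) → Fin (n G) → ℕ
degφ {G} C φ v =
  sum (map (λ u → if adj C (v , φ v) (u , φ u) then 1 else 0) (allFin (n G)))

Is0jColoring : (j : ℕ) {G : Multigraph} → TwoFoldCover G → HMap G → Set
Is0jColoring j C φ =
  ∀ v → (φ v ≡ false → degφ C φ v ≡ 0) × (φ v ≡ true → degφ C φ v ≤ j)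

Has0jColoring : (j : ℕ) {G : Multigraph} → TwoFoldCover G → Set
Has0jColoring j {G} C = Σ (HMap G) (Is0jColoring j C)

-- Subgraphs (up to relabelling of vertices): an injective vertex map f
-- with mult_H a b ≤ mult_G (f a) (f b).  Proper: not (f surjective and
-- all multiplicities equal).

record Subgraph (H G : Multigraph) : Set where
  field
    emb     : Fin (n H) → Fin (n G)
    emb-inj : Injective _≡_ _≡_ emb
    emb-le  : ∀ a b → mult H a b ≤ mult G (emb a) (emb b)
open Subgraph public

IsProper : {H G : Multigraph} → Subgraph H G → Set
IsProper {H} {G} S =
  ¬ (Surjective _≡_ _≡_ (emb S) × (∀ a b → mult H a b ≡ mult G (emb S a) (emb S b)))

Is0jCritical : ℕ → Multigraph → Set
Is0jCritical j G =
  (Σ (TwoFoldCover G) λ C → ¬ Has0jColoring j C) ×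
  (∀ (H : Multigraph) (S : Subgraph H G) → IsProper S →
     ∀ (C : TwoFoldCover H) → Has0jColoring j C)

-- vertices: cyc i = v_i (i = 0..m);  tri h 0/1/2 = x_{h+1}, y_{h+1}, u_{h+1}
data Vtx (m j : ℕ) : Set where
  cyc : Fin (suc m) → Vtx m j
  tri : Fin j → Fin 3 → Vtx m j

nG : ℕ → ℕ → ℕ
nG m j = suc m + j * 3

decode : (m j : ℕ) → Fin (nG m j) → Vtx m j
decode m j i with splitAt (suc m) i
... | inj₁ a = cyc a
... | inj₂ b with quotRem {j} 3 b
...   | (c , h) = tri h c

b2n : Bool → ℕ
b2n b = if b then 1 else 0

_==_ : {k : ℕ} → Fin k → Fin k → Bool
a == b = does (a F.≟ b)

-- directed edge list of G_m (each undirected edge listed in one direction):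
-- v_i → v_{i+1} (i < m), v_m → v_0, x_h → y_h, y_h → u_h, u_h → x_h, u_h → v_0
raw : {m j : ℕ} → Vtx m j → Vtx m j → ℕ
raw {m} (cyc a) (cyc b) =
  b2n ((toℕ b ≡ᵇ suc (toℕ a)) ∨ ((toℕ a ≡ᵇ m) ∧ (toℕ b ≡ᵇ 0)))
raw (tri h F.zero) (tri h' (F.suc F.zero)) = b2n (h == h')
raw (tri h (F.suc F.zero)) (tri h' (F.suc (F.suc F.zero))) = b2n (h == h')
raw (tri h (F.suc (F.suc F.zero))) (tri h' F.zero) = b2n (h == h')
raw (tri h (F.suc (F.suc F.zero))) (cyc b) = b2n (toℕ b ≡ᵇ 0)
raw _ _ = 0

multG : (m j : ℕ) → Fin (nG m j) → Fin (nG m j) → ℕ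
multG m j u v =
  if u == v then 0 else raw (decode m j u) (decode m j v) + raw (decode m j v) (decode m j u)

multG-sym : ∀ m j u v → multG m j u v ≡ multG m j v u
multG-sym m j u v with u F.≟ v | v F.≟ u
... | yes _ | yes _ = refl
... | yes refl | no ¬p = Data.Empty.⊥-elim (¬p refl)
  where import Data.Empty
... | no ¬p | yes refl = Data.Empty.⊥-elim (¬p refl)
  where import Data.Empty
... | no _ | no _ = +-comm (raw (decode m j u) (decode m j v)) (raw (decode m j v) (decode m j u))

multG-loopless : ∀ m j v → multG m j v v ≡ 0
multG-loopless m j v with v F.≟ v
... | yes _ = refl
... | no ¬p = Data.Empty.⊥-elim (¬p refl)
  where import Data.Empty

G : ℕ → ℕ → Multigraph
G m j = record
  { n = nG m j ; mult = multG m j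
  ; mult-sym = multG-sym m j ; loopless = multG-loopless m j }

-- A cover of G_m is described edge by edge by its link: which of the two perfect matchings of Bool,
-- straight (p–p, r–r) or crossed (p–r, r–p), it contains.
--
-- Uncolourable cover: crossed links along the path v₀ … v_m force all v_i into one state, and the
-- straight link on v_m v₀ (both links if m = 1) makes v₀ conflict, so v₀ is rich.  On a triangle, the
-- straight link x_h y_h and crossed links y_h u_h, u_h x_h force u_h to be rich, and the straight link
-- u_h v₀ then gives v₀ a conflict with every u_h: j + 1 conflicts in all.
--
-- Proper subgraphs: a cover of a proper subgraph H extends, by empty links, to a cover of G_m in which
-- some edge carries fewer matchings than its multiplicity, and colourings of the extension restrict
-- to H.  If the deficient edge lies on the cycle, walking forward and backward from v₀ and splitting
-- the cycle at that edge colours it without conflicts, whatever the state of v₀.  Otherwise v₀ is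
-- rich, the cycle is split where at most one conflict between rich ends remains, the deficient
-- triangle avoids v₀, and every other triangle costs v₀ at most one conflict.

module Submission where

open import Data.Nat using (ℕ; _≤_; _≥_)
open import Data.Product using (_,_)
open import Relation.Binary.PropositionalEquality using (_≢_)

module FinSum where

  open import Data.Nat using (ℕ; zero; suc; _+_; _≤_; z≤n; s≤s)
  open import Data.Nat.Properties
    using (+-0-commutativeMonoid; +-commutativeSemigroup; +-mono-≤; +-monoʳ-≤; ≤-trans; ≤-reflexive;
           m≤m+n; module ≤-Reasoning)
  open import Data.Fin using (Fin; zero; suc; punchIn; _≟_)
  open import Data.Fin.Properties using (suc-injective; 0≢1+n)
  open import Data.Vec.Functional using (updateAt; removeAt)
  open import Data.Vec.Functional.Properties using (updateAt-updates; updateAt-minimal)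
  open import Data.List using (List; []; _∷_; map; allFin; tabulate)
  open import Data.List.Properties using (map-tabulate)
  open import Data.List.Membership.Propositional using (_∈_)
  open import Data.List.Relation.Unary.Any using (here; there)
  import Data.Nat.ListAction as List
  open import Algebra.Properties.CommutativeSemigroup +-commutativeSemigroup using (x∙yz≈y∙xz)
  open import Function using (_∘_; const)
  open import Function.Definitions using (Injective)
  open import Relation.Nullary using (yes; no; contradiction)
  open import Relation.Nullary.Decidable using (decidable-stable)
  open import Relation.Binary.PropositionalEquality

  open import Algebra.Properties.CommutativeMonoid.Sum +-0-commutativeMonoid public
    using (sum; sum-syntax; sum-cong-≗; sum-remove)

  private variable
    n k : ℕ
    A : Set

  sum-tabulate : (f : Fin n → ℕ) → List.sum (tabulate f) ≡ ∑[ i < n ] f i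
  sum-tabulate {zero}  f = refl
  sum-tabulate {suc n} f = cong (f zero +_) (sum-tabulate (f ∘ suc))

  sum-map-allFin : (f : Fin n → ℕ) → List.sum (map f (allFin n)) ≡ ∑[ i < n ] f i
  sum-map-allFin f = trans (cong List.sum (map-tabulate (λ i → i) f)) (sum-tabulate f)

  ∑-mono-≤ : {f g : Fin n → ℕ} → (∀ i → f i ≤ g i) → ∑[ i < n ] f i ≤ ∑[ i < n ] g i
  ∑-mono-≤ {zero}  f≤g = z≤n
  ∑-mono-≤ {suc n} f≤g = +-mono-≤ (f≤g zero) (∑-mono-≤ (f≤g ∘ suc))

  ∑-zero : {f : Fin n → ℕ} → (∀ i → f i ≡ 0) → ∑[ i < n ] f i ≡ 0
  ∑-zero {zero}  f≡0 = refl
  ∑-zero {suc n} f≡0 = cong₂ _+_ (f≡0 zero) (∑-zero (f≡0 ∘ suc))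

  ∑-one : ∑[ i < n ] 1 ≡ n
  ∑-one {zero}  = refl
  ∑-one {suc n} = cong suc (∑-one {n})

  ∑-≤1 : {f : Fin n → ℕ} → (∀ i → f i ≤ 1) → ∑[ i < n ] f i ≤ n
  ∑-≤1 f≤1 = ≤-trans (∑-mono-≤ f≤1) (≤-reflexive ∑-one)

  ∑-≤1-with-zero : {f : Fin n → ℕ} → (∀ i → f i ≤ 1) → ∀ i → f i ≡ 0 → suc (∑[ i < n ] f i) ≤ n
  ∑-≤1-with-zero {suc n} {f} f≤1 i fi≡0 = begin
    suc (∑[ i < suc n ] f i)            ≡⟨ cong suc (sum-remove {i = i} f) ⟩
    suc (f i + sum (removeAt f i))      ≡⟨ cong (λ x → suc (x + sum (removeAt f i))) fi≡0 ⟩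
    suc (sum (removeAt f i))            ≤⟨ s≤s (∑-≤1 (f≤1 ∘ punchIn i)) ⟩
    suc n                               ∎
    where open ≤-Reasoning

  ≤∑ : (f : Fin n → ℕ) (i : Fin n) → f i ≤ ∑[ i < n ] f i
  ≤∑ {suc n} f i = ≤-trans (m≤m+n (f i) _) (≤-reflexive (sym (sum-remove {i = i} f)))

  erase : Fin n → (Fin n → ℕ) → Fin n → ℕ
  erase w f = updateAt f w (const 0)

  ∑-erase : (f : Fin n → ℕ) (w : Fin n) → ∑[ i < n ] f i ≡ f w + sum (erase w f)
  ∑-erase {suc n} f zero    = refl
  ∑-erase {suc n} f (suc w) = begin
    f zero + sum (f ∘ suc)                        ≡⟨ cong (f zero +_) (∑-erase (f ∘ suc) w) ⟩
    f zero + (f (suc w) + sum (erase w (f ∘ suc))) ≡⟨ x∙yz≈y∙xz (f zero) (f (suc w)) _ ⟩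
    f (suc w) + sum (erase (suc w) f)             ∎
    where open ≡-Reasoning

  ∑-inject-≤ : (f : Fin n → ℕ) (e : Fin k → Fin n) → Injective _≡_ _≡_ e →
               ∑[ i < k ] f (e i) ≤ ∑[ g < n ] f g
  ∑-inject-≤ {k = zero}  f e e-inj = z≤n
  ∑-inject-≤ {k = suc k} f e e-inj = begin
    f (e zero) + ∑[ i < k ] f (e (suc i))          ≡⟨ cong (f (e zero) +_) (sum-cong-≗ rest) ⟩
    f (e zero) + ∑[ i < k ] erase (e zero) f (e (suc i))
      ≤⟨ +-monoʳ-≤ (f (e zero)) (∑-inject-≤ (erase (e zero) f) (e ∘ suc) (suc-injective ∘ e-inj)) ⟩
    f (e zero) + sum (erase (e zero) f)            ≡⟨ sym (∑-erase f (e zero)) ⟩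
    ∑[ g < _ ] f g                                 ∎
    where
    open ≤-Reasoning
    rest : ∀ i → f (e (suc i)) ≡ erase (e zero) f (e (suc i))
    rest i = sym (updateAt-minimal (e (suc i)) (e zero) f (0≢1+n ∘ e-inj ∘ sym))

  erase-≤ : (f : Fin n → ℕ) (w g : Fin n) → erase w f g ≤ f g
  erase-≤ f w g with g ≟ w
  ... | yes refl = ≤-trans (≤-reflexive (updateAt-updates w f)) z≤n
  ... | no g≢w   = ≤-reflexive (updateAt-minimal g w f g≢w)

  sum-map-mono-≤ : {f g : A → ℕ} → (∀ x → f x ≤ g x) → (L : List A) →
                   List.sum (map f L) ≤ List.sum (map g L)
  sum-map-mono-≤ f≤g []      = z≤n
  sum-map-mono-≤ f≤g (x ∷ L) = +-mono-≤ (f≤g x) (sum-map-mono-≤ f≤g L)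

  ∑≤sum-map-support : (f : Fin n → ℕ) (L : List (Fin n)) → (∀ g → f g ≢ 0 → g ∈ L) →
                      ∑[ g < n ] f g ≤ List.sum (map f L)
  ∑≤sum-map-support f [] supp = ≤-reflexive (∑-zero outside)
    where
    outside : ∀ g → f g ≡ 0
    outside g = decidable-stable (f g Data.Nat.≟ 0) λ fg≢0 → contradiction (supp g fg≢0) λ ()
  ∑≤sum-map-support f (w ∷ L) supp = begin
    ∑[ g < _ ] f g                          ≡⟨ ∑-erase f w ⟩
    f w + sum (erase w f)                   ≤⟨ +-monoʳ-≤ (f w) (∑≤sum-map-support (erase w f) L supp′) ⟩
    f w + List.sum (map (erase w f) L)      ≤⟨ +-monoʳ-≤ (f w) (sum-map-mono-≤ (erase-≤ f w) L) ⟩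
    f w + List.sum (map f L)                ∎
    where
    open ≤-Reasoning
    supp′ : ∀ g → erase w f g ≢ 0 → g ∈ L
    supp′ g ≢0 with g ≟ w
    ... | yes refl = contradiction (updateAt-updates w f) ≢0
    ... | no g≢w with supp g (≢0 ∘ trans (updateAt-minimal g w f g≢w))
    ...   | here g≡w = contradiction g≡w g≢w
    ...   | there g∈L = g∈L

open FinSum

open import Defs

module Links where

  open import Data.Nat using (ℕ; zero; suc; _≤_; _<_; z≤n; s≤s; _<?_)
  open import Data.Nat.Properties using (≤-trans; ≤-reflexive; m≤n⇒m≤1+n)
  open import Data.Bool using (Bool; true; false; not; _xor_; if_then_else_)
  open import Data.Bool.Properties using (xor-comm; xor-same; not-injective; not-involutive; ⇔→≡)
  open import Data.Fin using (Fin; _≟_)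
  import Data.Fin.Properties as FinP
  open import Data.List using (List; []; _∷_; length)
  open import Data.List.Relation.Unary.Any as Any using (Any; here; there)
  open import Data.Product using (Σ; _×_; _,_; proj₁; proj₂)
  open import Data.Sum using (_⊎_; inj₁; inj₂)
  open import Data.Empty using (⊥; ⊥-elim)
  open import Function using (_∘_; _⇔_; mk⇔; Equivalence)
  open import Relation.Nullary using (Dec; yes; no; contradiction; ¬?; _×-dec_)
  open import Relation.Binary.PropositionalEquality

  data Link : Set where
    none straight crossed both : Link

  conflicts : Link → Bool → Bool → Bool
  conflicts none     s t = false
  conflicts straight s t = not (s xor t)
  conflicts crossed  s t = s xor t
  conflicts both     s t = true

  size : Link → ℕ
  size none     = 0
  size straight = 1
  size crossed  = 1
  size both     = 2

  size<2⇒≢both : ∀ {L} → size L < 2 → L ≢ both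
  size<2⇒≢both (s≤s (s≤s ())) refl

  conflicts⇒1≤size : ∀ L {s t} → conflicts L s t ≡ true → 1 ≤ size L
  conflicts⇒1≤size straight _ = s≤s z≤n
  conflicts⇒1≤size crossed  _ = s≤s z≤n
  conflicts⇒1≤size both     _ = s≤s z≤n

  size<1⇒none : ∀ {L} → size L < 1 → L ≡ none
  size<1⇒none {none}     _           = refl
  size<1⇒none {straight} (s≤s ())
  size<1⇒none {crossed}  (s≤s ())
  size<1⇒none {both}     (s≤s ())

  conflicts-sym : ∀ L s t → conflicts L s t ≡ conflicts L t s
  conflicts-sym none     s t = refl
  conflicts-sym straight s t = cong not (xor-comm s t)
  conflicts-sym crossed  s t = xor-comm s t
  conflicts-sym both     s t = refl

  conflicts-not : ∀ L s t → conflicts L (not s) (not t) ≡ conflicts L s t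
  conflicts-not none     s     t = refl
  conflicts-not straight true  t = refl
  conflicts-not straight false t = cong not (not-involutive t)
  conflicts-not crossed  true  t = refl
  conflicts-not crossed  false t = not-involutive t
  conflicts-not both     s     t = refl

  fromBits : Bool → Bool → Link
  fromBits false false = none
  fromBits true  false = straight
  fromBits false true  = crossed
  fromBits true  true  = both

  -- Only the conflicts of a poor vertex on the left are read; `R-not` below shows that this
  -- determines a relation made of perfect matchings.
  classify : (Bool → Bool → Bool) → Link
  classify R = fromBits (R false false) (R false true)

  classify-conflicts : ∀ L → classify (conflicts L) ≡ L
  classify-conflicts none     = refl
  classify-conflicts straight = refl
  classify-conflicts crossed  = refl
  classify-conflicts both     = refl

  conflicts-fromBits : ∀ a b t → conflicts (fromBits a b) false t ≡ (if t then b else a)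
  conflicts-fromBits false false true  = refl
  conflicts-fromBits false false false = refl
  conflicts-fromBits true  false true  = refl
  conflicts-fromBits true  false false = refl
  conflicts-fromBits false true  true  = refl
  conflicts-fromBits false true  false = refl
  conflicts-fromBits true  true  true  = refl
  conflicts-fromBits true  true  false = refl

  matching-id-or-not : (σ : PerfectMatching) → (∀ b → proj₁ σ b ≡ b) ⊎ (∀ b → proj₁ σ b ≡ not b)
  matching-id-or-not (σ , σ-inj) with σ false in eqF | σ true in eqT
  ... | false | true  = inj₁ λ { false → eqF ; true → eqT }
  ... | true  | false = inj₂ λ { false → eqF ; true → eqT }
  ... | false | false = contradiction (σ-inj (trans eqF (sym eqT))) λ ()
  ... | true  | true  = contradiction (σ-inj (trans eqF (sym eqT))) λ ()

  matching-not : (σ : PerfectMatching) (s : Bool) → proj₁ σ (not s) ≡ not (proj₁ σ s)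
  matching-not σ s with matching-id-or-not σ
  ... | inj₁ σ≡id  = trans (σ≡id (not s)) (cong not (sym (σ≡id s)))
  ... | inj₂ σ≡not = trans (σ≡not (not s)) (cong not (sym (σ≡not s)))

  nonempty : ∀ {A : Set} {P : A → Set} {xs} → Any P xs → 1 ≤ length xs
  nonempty (here _)  = s≤s z≤n
  nonempty (there _) = s≤s z≤n

  two-witnesses : ∀ {A : Set} {P Q : A → Set} {xs} → (∀ {x} → P x → Q x → ⊥) →
                  Any P xs → Any Q xs → 2 ≤ length xs
  two-witnesses disjoint (here p)  (here q)  = ⊥-elim (disjoint p q)
  two-witnesses disjoint (here _)  (there q) = s≤s (nonempty q)
  two-witnesses disjoint (there p) (here _)  = s≤s (nonempty p)
  two-witnesses disjoint (there p) (there q) = m≤n⇒m≤1+n (two-witnesses disjoint p q)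

  Hits : List PerfectMatching → Bool → Bool → Set
  Hits Ms s t = Any (λ σ → proj₁ σ s ≡ t) Ms

  module Classification {R : Bool → Bool → Bool} {Ms : List PerfectMatching}
                        (R⇔ : ∀ s t → (R s t ≡ true) ⇔ Hits Ms s t) where

    hits-not : ∀ {s t} → Hits Ms (not s) (not t) ⇔ Hits Ms s t
    hits-not {s} = mk⇔ (Any.map λ {σ} e → not-injective (trans (sym (matching-not σ s)) e))
                       (Any.map λ {σ} e → trans (matching-not σ s) (cong not e))

    R-not : ∀ s t → R (not s) (not t) ≡ R s t
    R-not s t = ⇔→≡ (mk⇔ (from (R⇔ s t) ∘ to hits-not ∘ to (R⇔ (not s) (not t)))
                         (from (R⇔ (not s) (not t)) ∘ from hits-not ∘ to (R⇔ s t)))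
      where open Equivalence

    R≡conflicts : ∀ s t → R s t ≡ conflicts (classify R) s t
    R≡conflicts false false = sym (conflicts-fromBits (R false false) (R false true) false)
    R≡conflicts false true  = sym (conflicts-fromBits (R false false) (R false true) true)
    R≡conflicts true  true  =
      trans (R-not false false) (trans (R≡conflicts false false) (sym (conflicts-not (classify R) false false)))
    R≡conflicts true  false =
      trans (R-not false true) (trans (R≡conflicts false true) (sym (conflicts-not (classify R) false true)))

    size-classify : size (classify R) ≤ length Ms
    size-classify with R false false in ff | R false true in ft
    ... | false | false = z≤n
    ... | true  | false = nonempty (to (R⇔ false false) ff)
      where open Equivalence
    ... | false | true  = nonempty (to (R⇔ false true) ft)
      where open Equivalence
    ... | true  | true  = two-witnesses (λ p q → contradiction (trans (sym p) q) λ ())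
                                        (to (R⇔ false false) ff) (to (R⇔ false true) ft)
      where open Equivalence

  module _ {G : Multigraph} (C : TwoFoldCover G) where

    link : Fin (n G) → Fin (n G) → Link
    link u v = classify (λ s t → adj C (u , s) (v , t))

    private
      module Edge {u v : Fin (n G)} (u≢v : u ≢ v) =
        Classification (proj₂ (proj₂ (adj-matchings C u v u≢v)))

    adj≡conflicts : ∀ {u v} → u ≢ v → ∀ s t → adj C (u , s) (v , t) ≡ conflicts (link u v) s t
    adj≡conflicts u≢v = Edge.R≡conflicts u≢v

    size-link≤mult : ∀ {u v} → u ≢ v → size (link u v) ≤ mult G u v
    size-link≤mult {u} {v} u≢v =
      ≤-trans (Edge.size-classify u≢v) (proj₁ (proj₂ (adj-matchings C u v u≢v)))

    adj⇒1≤mult : ∀ {u v s t} → u ≢ v → adj C (u , s) (v , t) ≡ true → 1 ≤ mult G u v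
    adj⇒1≤mult {u} {v} {s} {t} u≢v a≡true =
      ≤-trans (conflicts⇒1≤size (link u v) (trans (sym (adj≡conflicts u≢v s t)) a≡true)) (size-link≤mult u≢v)

    link-sym : ∀ {u v} → u ≢ v → link u v ≡ link v u
    link-sym {u} {v} u≢v = cong₂ fromBits
      (adj-sym C (u , false) (v , false))
      (trans (adj-sym C (u , false) (v , true)) (Edge.R-not (u≢v ∘ sym) false true))

    adj-within : ∀ v s t → adj C (v , s) (v , t) ≡ s xor t
    adj-within v false false = adj-irr C (v , false)
    adj-within v false true  = adj-pr C v
    adj-within v true  false = trans (adj-sym C (v , true) (v , false)) (adj-pr C v)
    adj-within v true  true  = adj-irr C (v , true)

  idMatching notMatching : PerfectMatching
  idMatching  = (λ b → b) , (λ e → e)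
  notMatching = not , not-injective

  matchings : Link → List PerfectMatching
  matchings none     = []
  matchings straight = idMatching ∷ []
  matchings crossed  = notMatching ∷ []
  matchings both     = idMatching ∷ notMatching ∷ []

  length-matchings : ∀ L → length (matchings L) ≡ size L
  length-matchings none     = refl
  length-matchings straight = refl
  length-matchings crossed  = refl
  length-matchings both     = refl

  conflicts⇔hits : ∀ L s t → (conflicts L s t ≡ true) ⇔ Hits (matchings L) s t
  conflicts⇔hits none     s     t     = mk⇔ (λ ()) (λ ())
  conflicts⇔hits straight true  true  = mk⇔ (λ _ → here refl) (λ _ → refl)
  conflicts⇔hits straight false false = mk⇔ (λ _ → here refl) (λ _ → refl)
  conflicts⇔hits straight true  false = mk⇔ (λ ()) λ { (here ()) ; (there ()) }
  conflicts⇔hits straight false true  = mk⇔ (λ ()) λ { (here ()) ; (there ()) }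
  conflicts⇔hits crossed  true  false = mk⇔ (λ _ → here refl) (λ _ → refl)
  conflicts⇔hits crossed  false true  = mk⇔ (λ _ → here refl) (λ _ → refl)
  conflicts⇔hits crossed  true  true  = mk⇔ (λ ()) λ { (here ()) ; (there ()) }
  conflicts⇔hits crossed  false false = mk⇔ (λ ()) λ { (here ()) ; (there ()) }
  conflicts⇔hits both     true  true  = mk⇔ (λ _ → here refl) (λ _ → refl)
  conflicts⇔hits both     false false = mk⇔ (λ _ → here refl) (λ _ → refl)
  conflicts⇔hits both     true  false = mk⇔ (λ _ → there (here refl)) (λ _ → refl)
  conflicts⇔hits both     false true  = mk⇔ (λ _ → there (here refl)) (λ _ → refl)

  module LinkCover (G : Multigraph) (L : Fin (n G) → Fin (n G) → Link)
                   (L-sym : ∀ u v → L u v ≡ L v u)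
                   (L-size : ∀ u v → u ≢ v → size (L u v) ≤ mult G u v) where

    linkAdj : CV (n G) → CV (n G) → Bool
    linkAdj (u , s) (v , t) with u ≟ v
    ... | yes _ = s xor t
    ... | no  _ = conflicts (L u v) s t

    linkAdj-≢ : ∀ {u v} → u ≢ v → ∀ s t → linkAdj (u , s) (v , t) ≡ conflicts (L u v) s t
    linkAdj-≢ {u} {v} u≢v s t with u ≟ v
    ... | yes u≡v = contradiction u≡v u≢v
    ... | no  _   = refl

    linkAdj-sym : ∀ x y → linkAdj x y ≡ linkAdj y x
    linkAdj-sym (u , s) (v , t) with u ≟ v | v ≟ u
    ... | yes _   | yes _   = xor-comm s t
    ... | no  _   | no  _   = trans (conflicts-sym (L u v) s t) (cong (λ K → conflicts K t s) (L-sym u v))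
    ... | yes u≡v | no  v≢u = contradiction (sym u≡v) v≢u
    ... | no  u≢v | yes v≡u = contradiction (sym v≡u) u≢v

    linkAdj-within : ∀ v s t → linkAdj (v , s) (v , t) ≡ s xor t
    linkAdj-within v s t with v ≟ v
    ... | yes _   = refl
    ... | no  v≢v = contradiction refl v≢v

    linkCover : TwoFoldCover G
    linkCover = record
      { adj           = linkAdj
      ; adj-sym       = linkAdj-sym
      ; adj-irr       = λ { (v , s) → trans (linkAdj-within v s s) (xor-same s) }
      ; adj-pr        = λ v → linkAdj-within v false true
      ; adj-matchings = λ u v u≢v →
          matchings (L u v) ,
          ≤-trans (≤-reflexive (length-matchings (L u v))) (L-size u v u≢v) ,
          λ s t → subst (λ b → (b ≡ true) ⇔ Hits (matchings (L u v)) s t)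
                        (sym (linkAdj-≢ u≢v s t)) (conflicts⇔hits (L u v) s t) }

    link-linkCover : ∀ {u v} → u ≢ v → link linkCover u v ≡ L u v
    link-linkCover {u} {v} u≢v =
      trans (cong₂ fromBits (linkAdj-≢ u≢v false false) (linkAdj-≢ u≢v false true))
            (classify-conflicts (L u v))

  Deficient : {G : Multigraph} → TwoFoldCover G → Set
  Deficient {G} C = Σ (Fin (n G)) λ u → Σ (Fin (n G)) λ v → u ≢ v × size (link C u v) < mult G u v

  deficient? : {G : Multigraph} (C : TwoFoldCover G) → Dec (Deficient C)
  deficient? {G} C = FinP.any? λ u → FinP.any? λ v → ¬? (u ≟ v) ×-dec (size (link C u v) <? mult G u v)

  b2n≤1 : ∀ b → b2n b ≤ 1
  b2n≤1 true  = s≤s z≤n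
  b2n≤1 false = z≤n

  Permitted : ℕ → Bool → ℕ → Set
  Permitted lim b d = (b ≡ false → d ≡ 0) × d ≤ lim

  Permitted-≤ : ∀ {lim b d d′} → d′ ≤ d → Permitted lim b d → Permitted lim b d′
  Permitted-≤ {d′ = zero}  _    _           = (λ _ → refl) , z≤n
  Permitted-≤ {d′ = suc _} d′≤d (poor , d≤) =
    (λ b≡false → contradiction (≤-trans d′≤d (≤-reflexive (poor b≡false))) λ ()) , ≤-trans d′≤d d≤

  Permitted-lim : ∀ {lim lim′ b d} → lim ≤ lim′ → Permitted lim b d → Permitted lim′ b d
  Permitted-lim lim≤ (poor , d≤) = poor , ≤-trans d≤ lim≤

open Links

module Gm (m j : ℕ) where

  open import Data.Nat using (zero; suc; _+_; _*_; _≤_; _<_; z≤n; s≤s; s≤s⁻¹; z<s; _≡ᵇ_; _%_)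
  open import Data.Nat.Properties
  open import Data.Nat.DivMod using (_mod_; m≤n⇒m%n≡m; n%n≡0; [m+n]%n≡m%n)
  open import Data.Fin as F using (Fin; toℕ; splitAt; quotRem; combine; _↑ˡ_; _↑ʳ_)
  open import Data.Fin.Patterns using (0F; 1F; 2F)
  import Data.Fin.Properties as FinP
  open import Data.Bool using (Bool; true; false; T; if_then_else_)
  open import Data.List using (List; []; _∷_; _++_; map; allFin)
  open import Data.List.Membership.Propositional using (_∈_)
  open import Data.List.Membership.Propositional.Properties using (∈-map⁺; ∈-allFin; ∈-++⁺ˡ; ∈-++⁺ʳ)
  open import Data.List.Relation.Unary.Any using (here; there)
  open import Data.Product using (Σ; _×_; _,_; proj₁; proj₂; swap)
  open import Data.Sum using (_⊎_; inj₁; inj₂)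
  open import Data.Unit using (tt)
  open import Function using (_∘_)
  open import Relation.Nullary using (yes; no; contradiction)
  open import Relation.Nullary.Decidable using (dec-true; dec-false)
  open import Relation.Binary.PropositionalEquality

  N : ℕ
  N = nG m j

  V : Set
  V = Vtx m j

  enc : V → Fin N
  enc (cyc a)   = a ↑ˡ (j * 3)
  enc (tri h c) = suc m ↑ʳ combine h c

  dec : Fin N → V
  dec = decode m j

  dec-enc : ∀ x → dec (enc x) ≡ x
  dec-enc (cyc a) rewrite FinP.splitAt-↑ˡ (suc m) a (j * 3) = refl
  dec-enc (tri h c) rewrite FinP.splitAt-↑ʳ (suc m) (j * 3) (combine h c)
                          | cong swap (FinP.remQuot-combine {k = 3} h c) = refl

  enc-dec : ∀ g → enc (dec g) ≡ g
  enc-dec g with splitAt (suc m) g in eq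
  ... | inj₁ a = trans (cong (F.join (suc m) (j * 3)) (sym eq)) (FinP.join-splitAt (suc m) (j * 3) g)
  ... | inj₂ b with quotRem {j} 3 b in eq′
  ...   | c , h = begin
    suc m ↑ʳ combine h c                         ≡⟨ cong (λ (c , h) → suc m ↑ʳ combine h c) (sym eq′) ⟩
    suc m ↑ʳ combine (proj₂ qr) (proj₁ qr)       ≡⟨ cong (suc m ↑ʳ_) (FinP.combine-remQuot {j} 3 b) ⟩
    F.join (suc m) (j * 3) (inj₂ b)              ≡⟨ cong (F.join (suc m) (j * 3)) (sym eq) ⟩
    F.join (suc m) (j * 3) (splitAt (suc m) g)   ≡⟨ FinP.join-splitAt (suc m) (j * 3) g ⟩
    g                                            ∎
    where
    open ≡-Reasoning
    qr = quotRem {j} 3 b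

  enc-injective : ∀ {x y} → enc x ≡ enc y → x ≡ y
  enc-injective {x} {y} e = trans (sym (dec-enc x)) (trans (cong dec e) (dec-enc y))

  enc-≢ : ∀ {x y} → x ≢ y → enc x ≢ enc y
  enc-≢ x≢y = x≢y ∘ enc-injective

  dec-≢ : ∀ {g g′} → g ≢ g′ → dec g ≢ dec g′
  dec-≢ {g} {g′} g≢g′ e = g≢g′ (trans (sym (enc-dec g)) (trans (cong enc e) (enc-dec g′)))

  edges : V → V → ℕ
  edges x y = raw x y + raw y x

  edges-sym : ∀ x y → edges x y ≡ edges y x
  edges-sym x y = +-comm (raw x y) (raw y x)

  multG-≢ : ∀ {g g′} → g ≢ g′ → multG m j g g′ ≡ edges (dec g) (dec g′)
  multG-≢ {g} {g′} g≢g′ = cong (λ b → if b then 0 else edges (dec g) (dec g′)) (dec-false (g F.≟ g′) g≢g′)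

  multG-enc : ∀ {x y} → x ≢ y → multG m j (enc x) (enc y) ≡ edges x y
  multG-enc {x} {y} x≢y = trans (multG-≢ (enc-≢ x≢y)) (cong₂ edges (dec-enc x) (dec-enc y))

  ≡ᵇ-true : ∀ {x y} → x ≡ y → (x ≡ᵇ y) ≡ true
  ≡ᵇ-true {x} {y} = dec-true (x Data.Nat.≟ y)

  ≡ᵇ-false : ∀ {x y} → x ≢ y → (x ≡ᵇ y) ≡ false
  ≡ᵇ-false {x} {y} = dec-false (x Data.Nat.≟ y)

  ≡ᵇ-sound : ∀ {x y} → (x ≡ᵇ y) ≡ true → x ≡ y
  ≡ᵇ-sound {x} {y} e = ≡ᵇ⇒≡ x y (subst T (sym e) tt)

  -- Positions on the cycle are read modulo m + 1, so position m + 1 is v₀ again.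
  pos : ℕ → Fin (suc m)
  pos i = i mod suc m

  toℕ-pos : ∀ i → toℕ (pos i) ≡ i % suc m
  toℕ-pos i = FinP.toℕ-fromℕ< _

  toℕ-pos-≤ : ∀ {i} → i ≤ m → toℕ (pos i) ≡ i
  toℕ-pos-≤ {i} i≤m = trans (toℕ-pos i) (m≤n⇒m%n≡m i≤m)

  toℕ≤m : ∀ (a : Fin (suc m)) → toℕ a ≤ m
  toℕ≤m a = s≤s⁻¹ (FinP.toℕ<n a)

  pos-toℕ : ∀ a → pos (toℕ a) ≡ a
  pos-toℕ a = FinP.toℕ-injective (toℕ-pos-≤ (toℕ≤m a))

  pos-suc-m : pos (suc m) ≡ 0F
  pos-suc-m = FinP.toℕ-injective (trans (toℕ-pos (suc m)) (n%n≡0 (suc m)))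

  next prev : Fin (suc m) → Fin (suc m)
  next a = pos (suc (toℕ a))
  prev a = pos (toℕ a + m)

  data Place (a : Fin (suc m)) : Set where
    inner : toℕ a < m → Place a
    last  : toℕ a ≡ m → Place a

  place : ∀ a → Place a
  place a with m≤n⇒m<n∨m≡n (toℕ≤m a)
  ... | inj₁ a<m = inner a<m
  ... | inj₂ a≡m = last a≡m

  toℕ-next-inner : ∀ {a} → toℕ a < m → toℕ (next a) ≡ suc (toℕ a)
  toℕ-next-inner = toℕ-pos-≤

  toℕ-next-last : ∀ {a} → toℕ a ≡ m → toℕ (next a) ≡ 0
  toℕ-next-last {a} a≡m = trans (toℕ-pos (suc (toℕ a))) (trans (cong (λ x → suc x % suc m) a≡m) (n%n≡0 (suc m)))

  next-pos : ∀ {i} → i ≤ m → next (pos i) ≡ pos (suc i)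
  next-pos i≤m = cong (pos ∘ suc) (toℕ-pos-≤ i≤m)

  next-pos-m : next (pos m) ≡ 0F
  next-pos-m = trans (next-pos ≤-refl) pos-suc-m

  toℕ-prev-suc : ∀ {a i} → toℕ a ≡ suc i → toℕ (prev a) ≡ i
  toℕ-prev-suc {a} {i} a≡1+i = begin
    toℕ (prev a)          ≡⟨ toℕ-pos (toℕ a + m) ⟩
    (toℕ a + m) % suc m   ≡⟨ cong (λ x → (x + m) % suc m) a≡1+i ⟩
    (suc i + m) % suc m   ≡⟨ cong (_% suc m) (sym (+-suc i m)) ⟩
    (i + suc m) % suc m   ≡⟨ [m+n]%n≡m%n i (suc m) ⟩
    i % suc m             ≡⟨ m≤n⇒m%n≡m (<⇒≤ (subst (_≤ m) a≡1+i (toℕ≤m a))) ⟩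
    i                     ∎
    where open ≡-Reasoning

  toℕ-prev-zero : ∀ {a} → toℕ a ≡ 0 → toℕ (prev a) ≡ m
  toℕ-prev-zero {a} a≡0 =
    trans (toℕ-pos (toℕ a + m)) (trans (cong (λ x → (x + m) % suc m) a≡0) (m≤n⇒m%n≡m ≤-refl))

  prev-next : ∀ a → prev (next a) ≡ a
  prev-next a with place a
  ... | inner a<m = FinP.toℕ-injective (toℕ-prev-suc (toℕ-next-inner a<m))
  ... | last  a≡m = FinP.toℕ-injective (trans (toℕ-prev-zero (toℕ-next-last a≡m)) (sym a≡m))

  next-prev : ∀ a → next (prev a) ≡ a
  next-prev a = FinP.toℕ-injective (by-toℕ (toℕ a) refl)
    where
    by-toℕ : ∀ k → toℕ a ≡ k → toℕ (next (prev a)) ≡ toℕ a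
    by-toℕ zero    a≡0   = trans (toℕ-next-last (toℕ-prev-zero a≡0)) (sym a≡0)
    by-toℕ (suc i) a≡1+i = trans (toℕ-next-inner prev<m) (trans (cong suc (toℕ-prev-suc a≡1+i)) (sym a≡1+i))
      where
      prev<m : toℕ (prev a) < m
      prev<m = subst (_< m) (sym (toℕ-prev-suc a≡1+i)) (subst (_≤ m) a≡1+i (toℕ≤m a))

  next-next : m ≡ 1 → ∀ a → next (next a) ≡ a
  next-next m≡1 a = trans (cong pos (trans (+-comm 1 (toℕ (next a))) (cong (toℕ (next a) +_) (sym m≡1)))) (prev-next a)

  pattern v₀  = cyc 0F
  pattern X h = tri h 0F
  pattern Y h = tri h 1F
  pattern U h = tri h 2F

  ==-refl : ∀ {k} (a : Fin k) → (a == a) ≡ true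
  ==-refl a = dec-true (a F.≟ a) refl

  raw-cycle : ∀ a b → raw {m} {j} (cyc a) (cyc b) ≢ 0 → b ≡ next a
  raw-cycle a b raw≢0 with toℕ b ≡ᵇ suc (toℕ a) in b≡1+a
  ... | true = FinP.toℕ-injective (trans (≡ᵇ-sound b≡1+a) (sym (toℕ-next-inner a<m)))
    where
    a<m : toℕ a < m
    a<m = subst (_≤ m) (≡ᵇ-sound b≡1+a) (toℕ≤m b)
  ... | false with toℕ a ≡ᵇ m in a≡m | toℕ b ≡ᵇ 0 in b≡0
  ...   | true  | true  = FinP.toℕ-injective (trans (≡ᵇ-sound b≡0) (sym (toℕ-next-last (≡ᵇ-sound a≡m))))
  ...   | true  | false = contradiction refl raw≢0
  ...   | false | _     = contradiction refl raw≢0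

  raw-next : ∀ a → raw {m} {j} (cyc a) (cyc (next a)) ≡ 1
  raw-next a with place a
  ... | inner a<m rewrite toℕ-next-inner a<m | ≡ᵇ-true {suc (toℕ a)} refl = refl
  ... | last  a≡m rewrite toℕ-next-last a≡m | ≡ᵇ-true a≡m = refl

  raw-next-back : 2 ≤ m → ∀ a → raw {m} {j} (cyc (next a)) (cyc a) ≡ 0
  raw-next-back 2≤m a with place a
  ... | inner a<m rewrite toℕ-next-inner a<m | ≡ᵇ-false {toℕ a} {suc (suc (toℕ a))} (<⇒≢ (m<n+m (toℕ a) z<s))
    with suc (toℕ a) ≡ᵇ m in 1+a≡m | toℕ a ≡ᵇ 0 in a≡0
  ...   | true  | true  =
    contradiction (trans (sym (≡ᵇ-sound 1+a≡m)) (cong suc (≡ᵇ-sound a≡0))) (<⇒≢ 2≤m ∘ sym)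
  ...   | true  | false = refl
  ...   | false | _     = refl
  raw-next-back 2≤m a | last a≡m rewrite toℕ-next-last a≡m | a≡m
    | ≡ᵇ-false {m} {1} (<⇒≢ 2≤m ∘ sym) | ≡ᵇ-false {0} {m} (<⇒≢ (≤-trans (s≤s z≤n) 2≤m)) = refl

  raw-next-back-1 : m ≡ 1 → ∀ a → raw {m} {j} (cyc (next a)) (cyc a) ≡ 1
  raw-next-back-1 m≡1 a with place a
  ... | inner a<m rewrite toℕ-next-inner a<m | n<1⇒n≡0 (subst (toℕ a <_) m≡1 a<m) | m≡1 = refl
  ... | last a≡m rewrite toℕ-next-last a≡m | a≡m | m≡1 = refl

  edges-next : 2 ≤ m → ∀ a → edges (cyc a) (cyc (next a)) ≡ 1
  edges-next 2≤m a = cong₂ _+_ (raw-next a) (raw-next-back 2≤m a)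

  edges-next-1 : m ≡ 1 → ∀ a → edges (cyc a) (cyc (next a)) ≡ 2
  edges-next-1 m≡1 a = cong₂ _+_ (raw-next a) (raw-next-back-1 m≡1 a)

  position : V → ℕ
  position (cyc a)   = toℕ a
  position (tri _ _) = 0

  cyc≢next : 1 ≤ m → ∀ a → cyc {m} {j} a ≢ cyc (next a)
  cyc≢next 1≤m a e with place a | cong position e
  ... | inner a<m | a≡next = <⇒≢ (n<1+n (toℕ a)) (trans a≡next (toℕ-next-inner a<m))
  ... | last  a≡m | a≡next = <⇒≢ 1≤m (sym (trans (sym a≡m) (trans a≡next (toℕ-next-last a≡m))))

  edges-xy : ∀ h → edges (X h) (Y h) ≡ 1
  edges-xy h = cong (λ b → b2n b + 0) (==-refl h)

  edges-yu : ∀ h → edges (Y h) (U h) ≡ 1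
  edges-yu h = cong (λ b → b2n b + 0) (==-refl h)

  edges-ux : ∀ h → edges (U h) (X h) ≡ 1
  edges-ux h = cong (λ b → b2n b + 0) (==-refl h)

  edges-uv : ∀ h → edges (U h) v₀ ≡ 1
  edges-uv h = refl

  data Edge : V → V → Set where
    cycle : ∀ a → Edge (cyc a) (cyc (next a))
    xy    : ∀ h → Edge (X h) (Y h)
    yu    : ∀ h → Edge (Y h) (U h)
    ux    : ∀ h → Edge (U h) (X h)
    uv    : ∀ h → Edge (U h) v₀

  raw≢0⇒Edge : ∀ x y → raw x y ≢ 0 → Edge x y
  raw≢0⇒Edge (cyc a) (cyc b) r≢0 rewrite raw-cycle a b r≢0 = cycle a
  raw≢0⇒Edge (X h) (Y h′) r≢0 with h F.≟ h′
  ... | yes refl = xy h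
  ... | no  _    = contradiction refl r≢0
  raw≢0⇒Edge (Y h) (U h′) r≢0 with h F.≟ h′
  ... | yes refl = yu h
  ... | no  _    = contradiction refl r≢0
  raw≢0⇒Edge (U h) (X h′) r≢0 with h F.≟ h′
  ... | yes refl = ux h
  ... | no  _    = contradiction refl r≢0
  raw≢0⇒Edge (U h) (cyc b) r≢0 with toℕ b in b≡0
  ... | zero rewrite FinP.toℕ-injective {i = b} {j = 0F} b≡0 = uv h
  ... | suc _ = contradiction refl r≢0
  raw≢0⇒Edge (cyc a) (tri h c) r≢0 = contradiction refl r≢0
  raw≢0⇒Edge (X h) (X h′) r≢0 = contradiction refl r≢0
  raw≢0⇒Edge (X h) (U h′) r≢0 = contradiction refl r≢0
  raw≢0⇒Edge (X h) (cyc b) r≢0 = contradiction refl r≢0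
  raw≢0⇒Edge (Y h) (X h′) r≢0 = contradiction refl r≢0
  raw≢0⇒Edge (Y h) (Y h′) r≢0 = contradiction refl r≢0
  raw≢0⇒Edge (Y h) (cyc b) r≢0 = contradiction refl r≢0
  raw≢0⇒Edge (U h) (Y h′) r≢0 = contradiction refl r≢0
  raw≢0⇒Edge (U h) (U h′) r≢0 = contradiction refl r≢0

  edges≢0⇒Edge : ∀ x y → edges x y ≢ 0 → Edge x y ⊎ Edge y x
  edges≢0⇒Edge x y e≢0 with raw x y in rxy
  ... | suc _ = inj₁ (raw≢0⇒Edge x y λ r≡0 → 0≢1+n (trans (sym r≡0) rxy))
  ... | zero  = inj₂ (raw≢0⇒Edge y x e≢0)

  -- For m = 1 the double edge v₀v₁ is listed once.
  cycleNeighbours : Fin (suc m) → List V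
  cycleNeighbours a = cyc (next a) ∷ (if m ≡ᵇ 1 then [] else cyc (prev a) ∷ [])

  tips : List V
  tips = map U (allFin j)

  neighbours : V → List V
  neighbours (cyc 0F)        = cycleNeighbours 0F ++ tips
  neighbours (cyc (F.suc a)) = cycleNeighbours (F.suc a)
  neighbours (X h)           = Y h ∷ U h ∷ []
  neighbours (Y h)           = X h ∷ U h ∷ []
  neighbours (U h)           = X h ∷ Y h ∷ v₀ ∷ []

  cycleNeighbours⊆ : ∀ {y} a → y ∈ cycleNeighbours a → y ∈ neighbours (cyc a)
  cycleNeighbours⊆ 0F        y∈ = ∈-++⁺ˡ y∈
  cycleNeighbours⊆ (F.suc a) y∈ = y∈

  prev∈cycleNeighbours : ∀ b → cyc b ∈ cycleNeighbours (next b)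
  prev∈cycleNeighbours b with m ≡ᵇ 1 in m≡1
  ... | true  = here (cong cyc (sym (next-next (≡ᵇ-sound m≡1) b)))
  ... | false = there (here (cong cyc (sym (prev-next b))))

  Edge⇒∈neighbours : ∀ {x y} → Edge x y → y ∈ neighbours x
  Edge⇒∈neighbours (cycle a) = cycleNeighbours⊆ a (here refl)
  Edge⇒∈neighbours (xy h)    = here refl
  Edge⇒∈neighbours (yu h)    = there (here refl)
  Edge⇒∈neighbours (ux h)    = here refl
  Edge⇒∈neighbours (uv h)    = there (there (here refl))

  Edge⇒∈neighbours′ : ∀ {x y} → Edge y x → y ∈ neighbours x
  Edge⇒∈neighbours′ (cycle b) = cycleNeighbours⊆ (next b) (prev∈cycleNeighbours b)
  Edge⇒∈neighbours′ (xy h)    = here refl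
  Edge⇒∈neighbours′ (yu h)    = there (here refl)
  Edge⇒∈neighbours′ (ux h)    = there (here refl)
  Edge⇒∈neighbours′ (uv h)    = ∈-++⁺ʳ (cycleNeighbours 0F) (∈-map⁺ U (∈-allFin h))

  edges≢0⇒∈neighbours : ∀ x y → edges x y ≢ 0 → y ∈ neighbours x
  edges≢0⇒∈neighbours x y e≢0 with edges≢0⇒Edge x y e≢0
  ... | inj₁ e = Edge⇒∈neighbours e
  ... | inj₂ e = Edge⇒∈neighbours′ e

  neighbour : 1 ≤ m → ∀ x → Σ V λ y → x ≢ y × 1 ≤ edges x y
  neighbour 1≤m (cyc a) = cyc (next a) , cyc≢next 1≤m a ,
    subst (_≤ edges (cyc a) (cyc (next a))) (raw-next a) (m≤m+n _ (raw (cyc (next a)) (cyc {m} {j} a)))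
  neighbour _   (X h)   = Y h , (λ ()) , ≤-reflexive (sym (edges-xy h))
  neighbour _   (Y h)   = U h , (λ ()) , ≤-reflexive (sym (edges-yu h))
  neighbour _   (U h)   = X h , (λ ()) , ≤-reflexive (sym (edges-ux h))

  nonisolated : 1 ≤ m → ∀ g → Σ (Fin N) λ g′ → g ≢ g′ × 1 ≤ multG m j g g′
  nonisolated 1≤m g with neighbour 1≤m (dec g)
  ... | y , x≢y , 1≤edges = enc y , (λ g≡ → x≢y (trans (cong dec g≡) (dec-enc y))) ,
    ≤-trans 1≤edges (≤-reflexive (sym (trans (cong (λ z → multG m j z (enc y)) (sym (enc-dec g))) (multG-enc x≢y))))

module CycleColouring (m : ℕ) (K : ℕ → Link) (simple : ∀ {i} → i ≤ m → K i ≢ both) where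

  open import Data.Nat using (zero; suc; _+_; _∸_; _<_; z≤n; s≤s; _≤?_)
  open import Data.Nat.Properties
  open import Data.Bool using (Bool; true; false; not; if_then_else_)
  open import Data.Bool.Properties using (xor-same; ¬-not)
  open import Data.Product using (Σ; _×_; _,_; proj₁; proj₂)
  open import Data.Sum using (inj₁; inj₂)
  open import Relation.Nullary using (yes; no; does; contradiction)
  open import Relation.Binary.Definitions using (tri<; tri≈; tri>)
  open import Relation.Nullary.Decidable using (dec-true; dec-false)
  open import Relation.Binary.PropositionalEquality
  open import Function using (_∘_; _∘′_)

  avoid : Link → Bool → Bool
  avoid straight b = not b
  avoid _        b = b

  avoid-free : ∀ {L} → L ≢ both → ∀ b → conflicts L b (avoid L b) ≡ false
  avoid-free {none}     _      b     = refl
  avoid-free {straight} _      true  = refl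
  avoid-free {straight} _      false = refl
  avoid-free {crossed}  _      b     = xor-same b
  avoid-free {both}     simple _     = contradiction refl simple

  conflict⇒not-avoid : ∀ {L} → L ≢ both → ∀ {b t} → conflicts L b t ≡ true → t ≡ not (avoid L b)
  conflict⇒not-avoid {straight} _ {true}  {true}  _ = refl
  conflict⇒not-avoid {straight} _ {false} {false} _ = refl
  conflict⇒not-avoid {crossed}  _ {true}  {false} _ = refl
  conflict⇒not-avoid {crossed}  _ {false} {true}  _ = refl
  conflict⇒not-avoid {both} simple _ = contradiction refl simple

  -- States are indexed by positions 0, …, m + 1 of the cycle (position m + 1 is v₀ again);
  -- edge i joins positions i and i + 1.
  Conflict : (ℕ → Bool) → ℕ → ℕ
  Conflict A i = b2n (conflicts (K i) (A i) (A (suc i)))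

  OnlyConflict : (ℕ → Bool) → ℕ → Set
  OnlyConflict A p = ∀ i → i ≤ m → i ≢ p → Conflict A i ≡ 0

  RichEnds : (ℕ → Bool) → ℕ → Set
  RichEnds A p = conflicts (K p) (A p) (A (suc p)) ≡ true → A p ≡ true × A (suc p) ≡ true

  poor⇒no-conflict : ∀ {b c} → (b ≡ true → c ≡ true) → c ≡ false → b2n b ≡ 0
  poor⇒no-conflict {false} _ _ = refl
  poor⇒no-conflict {true} rich c≡false with () ← trans (sym (rich refl)) c≡false

  inner-permitted : ∀ A p → OnlyConflict A p → RichEnds A p →
                    ∀ i → suc i ≤ m → Permitted 1 (A (suc i)) (Conflict A i + Conflict A (suc i))
  inner-permitted A p only rich i 1+i≤m with i ≟ p | suc i ≟ p
  ... | yes refl | yes 1+i≡i = contradiction (n<1+n i) (<-irrefl (sym 1+i≡i))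
  ... | yes refl | no 1+i≢i rewrite only (suc i) 1+i≤m 1+i≢i | +-identityʳ (Conflict A i) =
    poor⇒no-conflict (proj₂ ∘′ rich) , b2n≤1 _
  ... | no i≢p | yes refl rewrite only i (<⇒≤ 1+i≤m) i≢p =
    poor⇒no-conflict (proj₁ ∘′ rich) , b2n≤1 _
  ... | no i≢p | no 1+i≢p rewrite only i (<⇒≤ 1+i≤m) i≢p | only (suc i) 1+i≤m 1+i≢p = (λ _ → refl) , z≤n

  start-conflicts : 1 ≤ m → ∀ A p → OnlyConflict A p → Conflict A 0 + Conflict A m ≤ 1
  start-conflicts 1≤m A p only with 0 ≟ p
  ... | no 0≢p rewrite only 0 z≤n 0≢p = b2n≤1 _
  ... | yes refl rewrite only m ≤-refl (<⇒≢ 1≤m ∘ sym) | +-identityʳ (Conflict A 0) = b2n≤1 _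

  module Split (b₀ : Bool) where

    forward : ℕ → Bool
    forward zero    = b₀
    forward (suc i) = avoid (K i) (forward i)

    run-end : ∀ d k → k + d ≡ m → forward k ≡ b₀ →
              Σ ℕ λ p → p ≤ m × forward p ≡ b₀ × (p < m → forward (suc p) ≢ b₀)
    run-end zero    k k+0≡m fk = k , ≤-reflexive k≡m , fk , λ k<m → contradiction k≡m (<⇒≢ k<m)
      where k≡m = trans (sym (+-identityʳ k)) k+0≡m
    run-end (suc d) k k+d≡m fk with forward (suc k) Data.Bool.≟ b₀
    ... | no  fk+1≢b₀ = k , ≤-trans (m≤m+n k (suc d)) (≤-reflexive k+d≡m) , fk , λ _ → fk+1≢b₀
    ... | yes fk+1≡b₀ = run-end d (suc k) (trans (sym (+-suc k d)) k+d≡m) fk+1≡b₀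

    backwardFrom : ℕ → ℕ → Bool
    backwardFrom zero    i = b₀
    backwardFrom (suc d) i = avoid (K i) (backwardFrom d (suc i))

    backward : ℕ → Bool
    backward i = backwardFrom (suc m ∸ i) i

    backward-step : ∀ {i} → i ≤ m → backward i ≡ avoid (K i) (backward (suc i))
    backward-step i≤m rewrite +-∸-assoc 1 i≤m = refl

    backward-end : backward (suc m) ≡ b₀
    backward-end rewrite n∸n≡0 m = refl

    split : ℕ → ℕ → Bool
    split p i = if does (i ≤? p) then forward i else backward i

    split-≤ : ∀ {p i} → i ≤ p → split p i ≡ forward i
    split-≤ {p} {i} i≤p rewrite dec-true (i ≤? p) i≤p = refl

    split-> : ∀ {p i} → p < i → split p i ≡ backward i
    split-> {p} {i} p<i rewrite dec-false (i ≤? p) (<⇒≱ p<i) = refl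

    split-start : ∀ p → split p 0 ≡ b₀
    split-start p = split-≤ {p} z≤n

    split-end : ∀ {p} → p ≤ m → split p (suc m) ≡ b₀
    split-end p≤m = trans (split-> (s≤s p≤m)) backward-end

    only-split-edge : ∀ p → OnlyConflict (split p) p
    only-split-edge p i i≤m i≢p with <-cmp i p
    ... | tri< i<p _ _ rewrite split-≤ (<⇒≤ i<p) | split-≤ {p} {suc i} i<p =
      cong b2n (avoid-free (simple i≤m) (forward i))
    ... | tri≈ _ i≡p _ = contradiction i≡p i≢p
    ... | tri> _ _ p<i rewrite split-> p<i | split-> {p} {suc i} (<-trans p<i (n<1+n i)) | backward-step i≤m =
      cong b2n (trans (conflicts-sym (K i) _ _) (avoid-free (simple i≤m) (backward (suc i))))

  record CycleStates (c : ℕ) (b₀ : Bool) : Set where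
    field
      state       : ℕ → Bool
      state-start : state 0 ≡ b₀
      state-end   : state (suc m) ≡ b₀
      inner-ok    : ∀ i → suc i ≤ m → Permitted 1 (state (suc i)) (Conflict state i + Conflict state (suc i))
      start-ok    : Conflict state 0 + Conflict state m ≤ c

  free-cycle : ∀ {p} → p ≤ m → K p ≡ none → ∀ b₀ → CycleStates 0 b₀
  free-cycle {p} p≤m Kp≡none b₀ = record
    { state       = split p
    ; state-start = split-start p
    ; state-end   = split-end p≤m
    ; inner-ok    = λ i 1+i≤m → Permitted-≤ (≤-reflexive (cong₂ _+_ (no-conflict i (<⇒≤ 1+i≤m)) (no-conflict (suc i) 1+i≤m)))
                                            ((λ _ → refl) , z≤n)
    ; start-ok    = ≤-reflexive (cong₂ _+_ (no-conflict 0 z≤n) (no-conflict m ≤-refl))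
    }
    where
    open Split b₀
    no-conflict : ∀ i → i ≤ m → Conflict (split p) i ≡ 0
    no-conflict i i≤m with i ≟ p
    ... | yes refl = cong (λ L → b2n (conflicts L (split i i) (split i (suc i)))) Kp≡none
    ... | no i≢p   = only-split-edge p i i≤m i≢p

  -- From a rich v₀, walk forward to the end p of the initial run of rich states; splitting the cycle
  -- after p leaves at most the edge p in conflict, and both its ends are rich.
  rich-cycle : 1 ≤ m → CycleStates 1 true
  rich-cycle 1≤m with Split.run-end true m 0 refl refl
  ... | p , p≤m , fp , stop = record
    { state       = split p
    ; state-start = split-start p
    ; state-end   = split-end p≤m
    ; inner-ok    = inner-permitted (split p) p (only-split-edge p) rich-ends
    ; start-ok    = start-conflicts 1≤m (split p) p (only-split-edge p)
    }
    where
    open Split true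
    rich-ends : RichEnds (split p) p
    rich-ends conflict = trans (split-≤ (≤-refl {p})) fp , far-end
      where
      far-end : split p (suc p) ≡ true
      far-end with m≤n⇒m<n∨m≡n p≤m
      ... | inj₂ p≡m = subst (λ q → split p (suc q) ≡ true) (sym p≡m) (split-end p≤m)
      ... | inj₁ p<m = begin
        split p (suc p)        ≡⟨ split-> (n<1+n p) ⟩
        backward (suc p)       ≡⟨ conflict⇒not-avoid (simple p≤m) conflict′ ⟩
        not (forward (suc p))  ≡⟨ cong not (¬-not (stop p<m)) ⟩
        true                   ∎
        where
        open ≡-Reasoning
        conflict′ : conflicts (K p) (forward p) (backward (suc p)) ≡ true
        conflict′ = subst₂ (λ a b → conflicts (K p) a b ≡ true)
                           (split-≤ (≤-refl {p})) (split-> (n<1+n p)) conflict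

module Triangle where

  open import Data.Nat using (ℕ; zero; suc; _+_; z≤n; _≤ᵇ_)
  open import Data.Nat.Properties using (≤ᵇ⇒≤)
  open import Data.Bool using (Bool; true; false; not; _∧_; _∨_; T)
  open import Data.Bool.Properties using (T-∧; T-∨; T-not-≡)
  open import Data.Product using (Σ; _,_; proj₁; proj₂)
  open import Data.Sum using (_⊎_; inj₁; inj₂; [_,_]′)
  open import Data.Unit using (tt)
  open import Function using (_∘_; Equivalence)
  open import Relation.Nullary using (¬_; contradiction)
  open import Relation.Binary.PropositionalEquality

  private
    open Equivalence

    T-∧ˡ : ∀ a {b} → T (a ∧ b) → T a
    T-∧ˡ a = proj₁ ∘ to (T-∧ {a})

    T-∧ʳ : ∀ a {b} → T (a ∧ b) → T b
    T-∧ʳ a = proj₂ ∘ to (T-∧ {a})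

  record TriangleStates (lim : ℕ) (kxy kyu kux kuv : Link) (b₀ : Bool) : Set where
    field
      x y u : Bool
      x-ok  : Permitted lim x (b2n (conflicts kxy x y) + b2n (conflicts kux u x))
      y-ok  : Permitted lim y (b2n (conflicts kxy x y) + b2n (conflicts kyu y u))
      u-ok  : Permitted lim u (b2n (conflicts kux u x) + (b2n (conflicts kyu y u) + b2n (conflicts kuv u b₀)))

  permitted? : ℕ → Bool → ℕ → Bool
  permitted? lim true  d = d ≤ᵇ lim
  permitted? lim false zero    = true
  permitted? lim false (suc _) = false

  permitted?-sound : ∀ lim b d → T (permitted? lim b d) → Permitted lim b d
  permitted?-sound lim true  d     ok = (λ ()) , ≤ᵇ⇒≤ d lim ok
  permitted?-sound lim false zero  _  = (λ _ → refl) , z≤n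

  states? : ℕ → Link → Link → Link → Link → Bool → Bool → Bool → Bool → Bool
  states? lim kxy kyu kux kuv b₀ x y u =
    permitted? lim x (b2n (conflicts kxy x y) + b2n (conflicts kux u x)) ∧
    permitted? lim y (b2n (conflicts kxy x y) + b2n (conflicts kyu y u)) ∧
    permitted? lim u (b2n (conflicts kux u x) + (b2n (conflicts kyu y u) + b2n (conflicts kuv u b₀)))

  states?-sound : ∀ lim kxy kyu kux kuv b₀ x y u → T (states? lim kxy kyu kux kuv b₀ x y u) →
                  TriangleStates lim kxy kyu kux kuv b₀
  states?-sound lim kxy kyu kux kuv b₀ x y u ok = record
    { x = x ; y = y ; u = u
    ; x-ok = permitted?-sound lim x (b2n (conflicts kxy x y) + b2n (conflicts kux u x)) (T-∧ˡ (permitted? lim x _) ok)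
    ; y-ok = permitted?-sound lim y (b2n (conflicts kxy x y) + b2n (conflicts kyu y u))
                              (T-∧ˡ (permitted? lim y _) (T-∧ʳ (permitted? lim x _) ok))
    ; u-ok = permitted?-sound lim u (b2n (conflicts kux u x) + (b2n (conflicts kyu y u) + b2n (conflicts kuv u b₀)))
                              (T-∧ʳ (permitted? lim y _) (T-∧ʳ (permitted? lim x _) ok)) }

  witness-states : ∀ {lim kxy kyu kux kuv b₀} →
                   (Σ Bool λ x → Σ Bool λ y → Σ Bool λ u → T (states? lim kxy kyu kux kuv b₀ x y u)) →
                   TriangleStates lim kxy kyu kux kuv b₀
  witness-states (x , y , u , ok) = states?-sound _ _ _ _ _ _ x y u ok

  some : (Bool → Bool) → Bool
  some P = P false ∨ P true

  some-witness : ∀ P → T (some P) → Σ Bool (T ∘ P)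
  some-witness P ok with to T-∨ ok
  ... | inj₁ p = false , p
  ... | inj₂ p = true , p

  some³ : (Bool → Bool → Bool → Bool) → Bool
  some³ P = some λ x → some λ y → some λ u → P x y u

  some³-witness : ∀ P → T (some³ P) → Σ Bool λ x → Σ Bool λ y → Σ Bool λ u → T (P x y u)
  some³-witness P ok with some-witness _ ok
  ... | x , okx with some-witness _ okx
  ...   | y , oky with some-witness _ oky
  ...     | u , oku = x , y , u , oku

  simples : (Link → Bool) → Bool
  simples P = P none ∧ P straight ∧ P crossed

  simples-sound : ∀ P → T (simples P) → ∀ L → L ≢ both → T (P L)
  simples-sound P ok none     _ = T-∧ˡ (P none) ok
  simples-sound P ok straight _ = T-∧ˡ (P straight) (T-∧ʳ (P none) ok)
  simples-sound P ok crossed  _ = T-∧ʳ (P straight) (T-∧ʳ (P none) ok)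
  simples-sound P ok both     simple = contradiction refl simple

  simples⁴ : (Link → Link → Link → Link → Bool) → Bool
  simples⁴ P = simples λ a → simples λ b → simples λ c → simples λ d → P a b c d

  simples⁴-sound : ∀ P → T (simples⁴ P) →
                   ∀ {a b c d} → a ≢ both → b ≢ both → c ≢ both → d ≢ both → T (P a b c d)
  simples⁴-sound P ok {a} {b} {c} {d} sa sb sc sd =
    simples-sound (P a b c) (simples-sound (λ c → simples (P a b c))
      (simples-sound (λ b → simples λ c → simples (P a b c))
        (simples-sound (λ a → simples λ b → simples λ c → simples (P a b c)) ok a sa) b sb) c sc) d sd

  -- The three `…-check-ok` below are finite searches over all simple links on the four edges at a
  -- triangle and all states of x, y, u, carried out by normalisation.
  rich-check : Link → Link → Link → Link → Bool
  rich-check a b c d = some³ (states? 2 a b c d true)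

  rich-check-ok : T (simples⁴ rich-check)
  rich-check-ok = tt

  triangle-rich : ∀ {a b c d} → a ≢ both → b ≢ both → c ≢ both → d ≢ both → TriangleStates 2 a b c d true
  triangle-rich {a} {b} {c} {d} sa sb sc sd =
    witness-states (some³-witness (states? 2 a b c d true) (simples⁴-sound rich-check rich-check-ok sa sb sc sd))

  AvoidsV₀ : ∀ {lim kxy kyu kux kuv b₀} → TriangleStates lim kxy kyu kux kuv b₀ → Set
  AvoidsV₀ {kuv = kuv} {b₀} t = conflicts kuv (TriangleStates.u t) b₀ ≡ false

  avoiding? : ℕ → Link → Link → Link → Link → Bool → Bool → Bool → Bool → Bool
  avoiding? lim kxy kyu kux kuv b₀ x y u = states? lim kxy kyu kux kuv b₀ x y u ∧ not (conflicts kuv u b₀)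

  witness-avoiding : ∀ {lim kxy kyu kux kuv b₀} →
                     (Σ Bool λ x → Σ Bool λ y → Σ Bool λ u → T (avoiding? lim kxy kyu kux kuv b₀ x y u)) →
                     Σ (TriangleStates lim kxy kyu kux kuv b₀) AvoidsV₀
  witness-avoiding {lim} {kxy} {kyu} {kux} {kuv} {b₀} (x , y , u , ok) =
    witness-states (x , y , u , T-∧ˡ (states? lim kxy kyu kux kuv b₀ x y u) ok) ,
    to T-not-≡ (T-∧ʳ (states? lim kxy kyu kux kuv b₀ x y u) ok)

  isNone : Link → Bool
  isNone none = true
  isNone _    = false

  someNone : Link → Link → Link → Link → Bool
  someNone a b c d = isNone a ∨ isNone b ∨ isNone c ∨ isNone d

  someNone-sound : ∀ {a b c d} → a ≡ none ⊎ b ≡ none ⊎ c ≡ none ⊎ d ≡ none → T (someNone a b c d)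
  someNone-sound (inj₁ refl)               = tt
  someNone-sound {a} (inj₂ (inj₁ refl))    = from (T-∨ {isNone a}) (inj₂ tt)
  someNone-sound {a} {b} (inj₂ (inj₂ (inj₁ refl))) =
    from (T-∨ {isNone a}) (inj₂ (from (T-∨ {isNone b}) (inj₂ tt)))
  someNone-sound {a} {b} {c} (inj₂ (inj₂ (inj₂ refl))) =
    from (T-∨ {isNone a}) (inj₂ (from (T-∨ {isNone b}) (inj₂ (from (T-∨ {isNone c}) (inj₂ tt)))))

  T-not⇒¬T : ∀ {x} → T (not x) → ¬ T x
  T-not⇒¬T {false} _ ()

  deficient-check : Link → Link → Link → Link → Bool
  deficient-check a b c d = not (someNone a b c d) ∨ some³ (avoiding? 1 a b c d true)

  deficient-check-ok : T (simples⁴ deficient-check)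
  deficient-check-ok = tt

  triangle-deficient : ∀ {a b c d} → a ≢ both → b ≢ both → c ≢ both → d ≢ both →
                       a ≡ none ⊎ b ≡ none ⊎ c ≡ none ⊎ d ≡ none →
                       Σ (TriangleStates 1 a b c d true) AvoidsV₀
  triangle-deficient {a} {b} {c} {d} sa sb sc sd has-none =
    [ (λ no-none → contradiction (someNone-sound has-none) (T-not⇒¬T no-none))
    , witness-avoiding ∘ some³-witness (avoiding? 1 a b c d true) ]′
    (to (T-∨ {not (someNone a b c d)}) (simples⁴-sound deficient-check deficient-check-ok sa sb sc sd))

  single-check : Link → Link → Link → Link → Bool
  single-check a b c d = some³ (avoiding? 1 a b c d false) ∨ some³ (states? 1 a b c d true)

  single-check-ok : T (simples⁴ single-check)
  single-check-ok = tt

  triangle-single : ∀ {a b c d} → a ≢ both → b ≢ both → c ≢ both → d ≢ both →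
                    Σ (TriangleStates 1 a b c d false) AvoidsV₀ ⊎ TriangleStates 1 a b c d true
  triangle-single {a} {b} {c} {d} sa sb sc sd =
    [ inj₁ ∘ witness-avoiding ∘ some³-witness (avoiding? 1 a b c d false)
    , inj₂ ∘ witness-states ∘ some³-witness (states? 1 a b c d true) ]′
    (to (T-∨ {some³ (avoiding? 1 a b c d false)}) (simples⁴-sound single-check single-check-ok sa sb sc sd))

open Triangle

module Extension {H G : Multigraph} (S : Subgraph H G) (C : TwoFoldCover H) where

  open import Data.Nat using (ℕ; _≤_; z≤n)
  open import Data.Nat.Properties
    using (≤-trans; ≤-reflexive; ≤-antisym; ≮⇒≥; n≤0⇒n≡0; module ≤-Reasoning)
  open import Data.Fin using (Fin; _≟_)
  import Data.Fin.Properties as FinP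
  open import Data.Product using (Σ; ∃; _×_; _,_; proj₁; proj₂)
  open import Relation.Nullary using (Dec; yes; no; contradiction)
  open import Relation.Binary.PropositionalEquality
  open import Function using (_∘_)

  private
    e : Fin (n H) → Fin (n G)
    e = emb S

  preimage? : ∀ g → Dec (∃ λ a → e a ≡ g)
  preimage? g = FinP.any? λ a → e a ≟ g

  extLink : Fin (n G) → Fin (n G) → Link
  extLink g g′ with preimage? g | preimage? g′
  ... | yes (a , _) | yes (b , _) = link C a b
  ... | _           | _           = none

  extLink-emb : ∀ a b → extLink (e a) (e b) ≡ link C a b
  extLink-emb a b with preimage? (e a) | preimage? (e b)
  ... | yes (a′ , p) | yes (b′ , q) = cong₂ (link C) (emb-inj S p) (emb-inj S q)
  ... | no ¬p        | _            = contradiction (a , refl) ¬p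
  ... | yes _        | no ¬q        = contradiction (b , refl) ¬q

  extLink-sym : ∀ g g′ → extLink g g′ ≡ extLink g′ g
  extLink-sym g g′ with preimage? g | preimage? g′
  ... | yes (a , refl) | yes (b , refl) with a ≟ b
  ...   | yes refl = refl
  ...   | no a≢b   = link-sym C a≢b
  extLink-sym g g′ | yes _ | no _  = refl
  extLink-sym g g′ | no _  | yes _ = refl
  extLink-sym g g′ | no _  | no _  = refl

  extLink-size : ∀ g g′ → g ≢ g′ → size (extLink g g′) ≤ mult G g g′
  extLink-size g g′ g≢g′ with preimage? g | preimage? g′
  ... | yes (a , refl) | yes (b , refl) =
    ≤-trans (size-link≤mult C (g≢g′ ∘ cong e)) (emb-le S a b)
  ... | yes _ | no _ = z≤n
  ... | no _  | _    = z≤n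

  open LinkCover G extLink extLink-sym extLink-size

  extension : TwoFoldCover G
  extension = linkCover

  adj-extension-emb : ∀ a s b t → adj extension (e a , s) (e b , t) ≡ adj C (a , s) (b , t)
  adj-extension-emb a s b t with a ≟ b
  ... | yes refl = trans (linkAdj-within (e a) s t) (sym (adj-within C a s t))
  ... | no a≢b = begin
    adj extension (e a , s) (e b , t)   ≡⟨ linkAdj-≢ (a≢b ∘ emb-inj S) s t ⟩
    conflicts (extLink (e a) (e b)) s t ≡⟨ cong (λ L → conflicts L s t) (extLink-emb a b) ⟩
    conflicts (link C a b) s t          ≡⟨ sym (adj≡conflicts C a≢b s t) ⟩
    adj C (a , s) (b , t)               ∎
    where open ≡-Reasoning

  degφ-restrict : ∀ φ v → degφ C (φ ∘ e) v ≤ degφ extension φ (e v)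
  degφ-restrict φ v = begin
    degφ C (φ ∘ e) v                                   ≡⟨ sum-map-allFin conflictH ⟩
    ∑[ b < n H ] conflictH b                           ≡⟨ sum-cong-≗ (cong b2n ∘ sym ∘ restricted) ⟩
    ∑[ b < n H ] conflictG (e b)                       ≤⟨ ∑-inject-≤ conflictG e (emb-inj S) ⟩
    ∑[ g < n G ] conflictG g                           ≡⟨ sum-map-allFin conflictG ⟨
    degφ extension φ (e v)                             ∎
    where
    open ≤-Reasoning
    conflictH : Fin (n H) → ℕ
    conflictH b = b2n (adj C (v , φ (e v)) (b , φ (e b)))
    conflictG : Fin (n G) → ℕ
    conflictG g = b2n (adj extension (e v , φ (e v)) (g , φ g))
    restricted : ∀ b → adj extension (e v , φ (e v)) (e b , φ (e b)) ≡ adj C (v , φ (e v)) (b , φ (e b))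
    restricted b = adj-extension-emb v (φ (e v)) b (φ (e b))

  restrict : ∀ j → Has0jColoring j extension → Has0jColoring j C
  restrict j (φ , φ-col) = φ ∘ e , λ v →
    (λ poor → n≤0⇒n≡0 (≤-trans (degφ-restrict φ v) (≤-reflexive (proj₁ (φ-col (e v)) poor)))) ,
    (λ rich → ≤-trans (degφ-restrict φ v) (proj₂ (φ-col (e v)) rich))

  proper⇒deficient : (∀ g → Σ (Fin (n G)) λ g′ → g ≢ g′ × 1 ≤ mult G g g′) →
                     IsProper S → Deficient extension
  proper⇒deficient neighbour proper with deficient? extension
  ... | yes deficient = deficient
  ... | no ¬deficient = contradiction (surjective , mult-preserved) proper
    where
    saturated : ∀ {g g′} → g ≢ g′ → mult G g g′ ≤ size (extLink g g′)
    saturated {g} {g′} g≢g′ =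
      ≤-trans (≮⇒≥ λ lt → ¬deficient (g , g′ , g≢g′ , lt))
              (≤-reflexive (cong size (link-linkCover g≢g′)))

    surjective : ∀ g → ∃ λ a → ∀ {z} → z ≡ a → e z ≡ g
    surjective g with preimage? g in eq
    ... | yes (a , ea≡g) = a , λ { refl → ea≡g }
    ... | no _ with neighbour g
    ...   | g′ , g≢g′ , 1≤mult with ≤-trans 1≤mult (saturated g≢g′)
    ...     | 1≤size rewrite eq with () ← 1≤size

    mult-preserved : ∀ a b → mult H a b ≡ mult G (e a) (e b)
    mult-preserved a b with a ≟ b
    ... | yes refl = trans (loopless H a) (sym (loopless G (e a)))
    ... | no a≢b = ≤-antisym (emb-le S a b) (begin
      mult G (e a) (e b)        ≤⟨ saturated (a≢b ∘ emb-inj S) ⟩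
      size (extLink (e a) (e b)) ≡⟨ cong size (extLink-emb a b) ⟩
      size (link C a b)         ≤⟨ size-link≤mult C a≢b ⟩
      mult H a b                ∎)
      where open ≤-Reasoning

module Uncolourable (m j : ℕ) where

  open import Data.Nat using (zero; suc; _≤_; _<_; z≤n; s≤s; _≡ᵇ_)
  open import Data.Nat.Properties
  open import Data.Fin as F using (Fin; toℕ)
  open import Data.Fin.Patterns using (0F)
  open import Data.Bool using (Bool; true; false; not; _∧_; _∨_; _xor_)
  open import Data.Bool.Properties using (∨-comm; ∧-zeroʳ; xor-same; ¬-not)
  open import Data.Product using (_,_; proj₁; proj₂)
  open import Data.Sum using (inj₁; inj₂)
  open import Function using (_∘_)
  open import Relation.Nullary using (¬_; contradiction)
  open import Data.Empty using (⊥)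
  open import Relation.Binary.PropositionalEquality
  open Gm m j

  closing : Fin (suc m) → Fin (suc m) → Bool
  closing a b = ((toℕ a ≡ᵇ m) ∧ (toℕ b ≡ᵇ 0)) ∨ ((toℕ b ≡ᵇ m) ∧ (toℕ a ≡ᵇ 0))

  straightPair : V → V → Bool
  straightPair (cyc a) (cyc b) = closing a b
  straightPair (X _)   (Y _)   = true
  straightPair (Y _)   (X _)   = true
  straightPair (U _)   (cyc _) = true
  straightPair (cyc _) (U _)   = true
  straightPair _       _       = false

  straightPair-sym : ∀ x y → straightPair x y ≡ straightPair y x
  straightPair-sym (cyc a) (cyc b) = ∨-comm ((toℕ a ≡ᵇ m) ∧ (toℕ b ≡ᵇ 0)) _
  straightPair-sym (cyc a) (X _)   = refl
  straightPair-sym (cyc a) (Y _)   = refl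
  straightPair-sym (cyc a) (U _)   = refl
  straightPair-sym (X _)   (cyc b) = refl
  straightPair-sym (Y _)   (cyc b) = refl
  straightPair-sym (U _)   (cyc b) = refl
  straightPair-sym (X _)   (X _)   = refl
  straightPair-sym (X _)   (Y _)   = refl
  straightPair-sym (X _)   (U _)   = refl
  straightPair-sym (Y _)   (X _)   = refl
  straightPair-sym (Y _)   (Y _)   = refl
  straightPair-sym (Y _)   (U _)   = refl
  straightPair-sym (U _)   (X _)   = refl
  straightPair-sym (U _)   (Y _)   = refl
  straightPair-sym (U _)   (U _)   = refl

  linkOfSize : ℕ → Bool → Link
  linkOfSize zero          _     = none
  linkOfSize (suc zero)    true  = straight
  linkOfSize (suc zero)    false = crossed
  linkOfSize (suc (suc _)) _     = both

  size-linkOfSize : ∀ k b → size (linkOfSize k b) ≤ k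
  size-linkOfSize zero          _     = z≤n
  size-linkOfSize (suc zero)    true  = ≤-refl
  size-linkOfSize (suc zero)    false = ≤-refl
  size-linkOfSize (suc (suc k)) _     = s≤s (s≤s z≤n)

  badLinkV : V → V → Link
  badLinkV x y = linkOfSize (edges x y) (straightPair x y)

  badLink : Fin N → Fin N → Link
  badLink g g′ = badLinkV (dec g) (dec g′)

  badLinkV-sym : ∀ x y → badLinkV x y ≡ badLinkV y x
  badLinkV-sym x y = cong₂ linkOfSize (edges-sym x y) (straightPair-sym x y)

  badLink-sym : ∀ g g′ → badLink g g′ ≡ badLink g′ g
  badLink-sym g g′ = badLinkV-sym (dec g) (dec g′)

  badLink-size : ∀ g g′ → g ≢ g′ → size (badLink g g′) ≤ multG m j g g′
  badLink-size g g′ g≢g′ =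
    ≤-trans (size-linkOfSize (edges (dec g) (dec g′)) _) (≤-reflexive (sym (multG-≢ g≢g′)))

  open LinkCover (G m j) badLink badLink-sym badLink-size using (linkCover; linkAdj-≢)

  badCover : TwoFoldCover (G m j)
  badCover = linkCover

  adj-badCover : ∀ {x y} → x ≢ y → ∀ s t → adj badCover (enc x , s) (enc y , t) ≡ conflicts (badLinkV x y) s t
  adj-badCover {x} {y} x≢y s t =
    trans (linkAdj-≢ (enc-≢ x≢y) s t)
          (cong₂ (λ x′ y′ → conflicts (badLinkV x′ y′) s t) (dec-enc x) (dec-enc y))

  straight-refl : ∀ b → conflicts straight b b ≡ true
  straight-refl b = cong not (xor-same b)

  link-xy : ∀ h → badLinkV (X h) (Y h) ≡ straight
  link-xy h = cong (λ k → linkOfSize k true) (edges-xy h)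

  link-yu : ∀ h → badLinkV (Y h) (U h) ≡ crossed
  link-yu h = cong (λ k → linkOfSize k false) (edges-yu h)

  link-ux : ∀ h → badLinkV (U h) (X h) ≡ crossed
  link-ux h = cong (λ k → linkOfSize k false) (edges-ux h)

  inner-not-closing : 2 ≤ m → ∀ {i} → i < m → closing (pos i) (next (pos i)) ≡ false
  inner-not-closing 2≤m {i} i<m
    rewrite toℕ-next-inner {pos i} (subst (_< m) (sym (toℕ-pos-≤ (<⇒≤ i<m))) i<m)
          | toℕ-pos-≤ (<⇒≤ i<m) | ≡ᵇ-false (<⇒≢ i<m) = not-from-v₀ i
    where
    not-from-v₀ : ∀ i → ((suc i ≡ᵇ m) ∧ (i ≡ᵇ 0)) ≡ false
    not-from-v₀ zero    = cong (_∧ true) (≡ᵇ-false {1} {m} (<⇒≢ 2≤m))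
    not-from-v₀ (suc i) = ∧-zeroʳ (suc (suc i) ≡ᵇ m)

  link-cycle : 2 ≤ m → ∀ {i} → i < m → badLinkV (cyc (pos i)) (cyc (pos (suc i))) ≡ crossed
  link-cycle 2≤m {i} i<m = begin
    badLinkV (cyc (pos i)) (cyc (pos (suc i)))
      ≡⟨ cong (badLinkV (cyc (pos i)) ∘ cyc) (sym (next-pos (<⇒≤ i<m))) ⟩
    badLinkV (cyc (pos i)) (cyc (next (pos i)))
      ≡⟨ cong₂ linkOfSize (edges-next 2≤m (pos i)) (inner-not-closing 2≤m i<m) ⟩
    crossed
      ∎
    where open ≡-Reasoning

  vₘ : V
  vₘ = cyc (pos m)

  link-closing : 2 ≤ m → badLinkV vₘ v₀ ≡ straight
  link-closing 2≤m = cong₂ linkOfSize edges≡1 is-closing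
    where
    edges≡1 : edges vₘ v₀ ≡ 1
    edges≡1 = trans (cong (edges vₘ ∘ cyc) (sym next-pos-m)) (edges-next 2≤m (pos m))
    is-closing : closing (pos m) 0F ≡ true
    is-closing rewrite toℕ-pos-≤ (≤-refl {m}) | ≡ᵇ-true (refl {x = m}) = refl

  link-closing-1 : m ≡ 1 → badLinkV vₘ v₀ ≡ both
  link-closing-1 m≡1 = cong (λ k → linkOfSize k (straightPair vₘ v₀))
    (trans (cong (edges vₘ ∘ cyc) (sym next-pos-m)) (edges-next-1 m≡1 (pos m)))

  vₘ≢v₀ : 1 ≤ m → vₘ ≢ v₀
  vₘ≢v₀ 1≤m vₘ≡v₀ = <⇒≢ 1≤m (sym (trans (sym (toℕ-pos-≤ ≤-refl)) (cong position vₘ≡v₀)))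

  module NoColouring (1≤m : 1 ≤ m) (φ : Fin N → Bool) (φ-col : Is0jColoring j badCover φ) where

    ψ : V → Bool
    ψ = φ ∘ enc

    conflict⇒degree : ∀ {x y} → x ≢ y → conflicts (badLinkV x y) (ψ x) (ψ y) ≡ true →
                      1 ≤ degφ badCover φ (enc x)
    conflict⇒degree {x} {y} x≢y c = begin
      1                                  ≡⟨ cong b2n (sym (trans (adj-badCover x≢y (ψ x) (ψ y)) c)) ⟩
      conflictsAt (enc y)                ≤⟨ ≤∑ conflictsAt (enc y) ⟩
      ∑[ g < N ] conflictsAt g           ≡⟨ sum-map-allFin conflictsAt ⟨
      degφ badCover φ (enc x)            ∎
      where
      open ≤-Reasoning
      conflictsAt : Fin N → ℕ
      conflictsAt g = b2n (adj badCover (enc x , ψ x) (g , φ g))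

    degree⇒rich : ∀ {g} → 1 ≤ degφ badCover φ g → φ g ≡ true
    degree⇒rich {g} 1≤deg = ¬-not λ poor → contradiction (subst (1 ≤_) (proj₁ (φ-col g) poor) 1≤deg) λ ()

    conflict⇒rich : ∀ {x y} → x ≢ y → conflicts (badLinkV x y) (ψ x) (ψ y) ≡ true → ψ x ≡ true
    conflict⇒rich x≢y = degree⇒rich ∘ conflict⇒degree x≢y

    crossed⇒equal : ∀ {x y} → x ≢ y → badLinkV x y ≡ crossed → ψ x ≡ ψ y
    crossed⇒equal {x} {y} x≢y L≡ with ψ x in ψx≡ | ψ y in ψy≡
    ... | true  | true  = refl
    ... | false | false = refl
    ... | false | true  = contradiction (trans (sym ψx≡) (conflict⇒rich x≢y differ)) λ ()
      where
      differ : conflicts (badLinkV x y) (ψ x) (ψ y) ≡ true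
      differ = trans (cong (λ L → conflicts L (ψ x) (ψ y)) L≡) (cong₂ _xor_ ψx≡ ψy≡)
    ... | true  | false = contradiction (trans (sym ψy≡) (conflict⇒rich (x≢y ∘ sym) differ)) λ ()
      where
      differ : conflicts (badLinkV y x) (ψ y) (ψ x) ≡ true
      differ = trans (cong (λ L → conflicts L (ψ y) (ψ x)) (trans (badLinkV-sym y x) L≡)) (cong₂ _xor_ ψy≡ ψx≡)

    tips-rich : ∀ h → ψ (U h) ≡ true
    tips-rich h = trans (crossed⇒equal {U h} {X h} (λ ()) (link-ux h)) (conflict⇒rich {X h} {Y h} (λ ()) xy-conflict)
      where
      y≡x : ψ (Y h) ≡ ψ (X h)
      y≡x = trans (crossed⇒equal {Y h} {U h} (λ ()) (link-yu h)) (crossed⇒equal {U h} {X h} (λ ()) (link-ux h))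
      xy-conflict : conflicts (badLinkV (X h) (Y h)) (ψ (X h)) (ψ (Y h)) ≡ true
      xy-conflict = trans (cong₂ (λ L b → conflicts L (ψ (X h)) b) (link-xy h) y≡x) (straight-refl (ψ (X h)))

    path-constant : 2 ≤ m → ∀ {i} → i ≤ m → ψ (cyc (pos i)) ≡ ψ v₀
    path-constant 2≤m {zero}  _     = refl
    path-constant 2≤m {suc i} 1+i≤m =
      trans (sym (crossed⇒equal vi≢vi+1 (link-cycle 2≤m 1+i≤m))) (path-constant 2≤m (<⇒≤ 1+i≤m))
      where
      vi≢vi+1 : cyc (pos i) ≢ cyc (pos (suc i))
      vi≢vi+1 = subst (λ b → cyc (pos i) ≢ cyc b) (next-pos (<⇒≤ 1+i≤m)) (cyc≢next 1≤m (pos i))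

    closing-conflict : conflicts (badLinkV vₘ v₀) (ψ vₘ) (ψ v₀) ≡ true
    closing-conflict with m≤n⇒m<n∨m≡n 1≤m
    ... | inj₁ 2≤m =
      trans (cong₂ (λ L b → conflicts L b (ψ v₀)) (link-closing 2≤m) (path-constant 2≤m ≤-refl))
            (straight-refl (ψ v₀))
    ... | inj₂ 1≡m = cong (λ L → conflicts L (ψ vₘ) (ψ v₀)) (link-closing-1 (sym 1≡m))

    v₀-conflict : conflicts (badLinkV v₀ vₘ) (ψ v₀) (ψ vₘ) ≡ true
    v₀-conflict = trans (cong (λ L → conflicts L (ψ v₀) (ψ vₘ)) (badLinkV-sym v₀ vₘ))
                        (trans (conflicts-sym (badLinkV vₘ v₀) (ψ v₀) (ψ vₘ)) closing-conflict)

    targets : Fin (suc j) → Fin N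
    targets 0F        = enc vₘ
    targets (F.suc h) = enc (U h)

    targets-injective : ∀ {a b} → targets a ≡ targets b → a ≡ b
    targets-injective {0F}      {0F}      _ = refl
    targets-injective {F.suc a} {F.suc b} e with enc-injective {U a} {U b} e
    ... | refl = refl
    targets-injective {0F}      {F.suc b} e with () ← enc-injective {vₘ} {U b} e
    targets-injective {F.suc a} {0F}      e with () ← enc-injective {U a} {vₘ} e

    v₀-rich : ψ v₀ ≡ true
    v₀-rich = conflict⇒rich (vₘ≢v₀ 1≤m ∘ sym) v₀-conflict

    conflictsAtv₀ : Fin N → ℕ
    conflictsAtv₀ g = b2n (adj badCover (enc v₀ , ψ v₀) (g , φ g))

    targets-conflict : ∀ i → 1 ≤ conflictsAtv₀ (targets i)
    targets-conflict 0F =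
      ≤-reflexive (cong b2n (sym (trans (adj-badCover (vₘ≢v₀ 1≤m ∘ sym) (ψ v₀) (ψ vₘ)) v₀-conflict)))
    targets-conflict (F.suc h) = ≤-reflexive (cong b2n (sym (begin
      adj badCover (enc v₀ , ψ v₀) (enc (U h) , ψ (U h)) ≡⟨ adj-badCover {v₀} {U h} (λ ()) (ψ v₀) (ψ (U h)) ⟩
      conflicts straight (ψ v₀) (ψ (U h))               ≡⟨ cong₂ (conflicts straight) v₀-rich (tips-rich h) ⟩
      true                                               ∎)))
      where open ≡-Reasoning

    absurd : ⊥
    absurd = 1+n≰n (begin
      suc j                                   ≡⟨ ∑-one ⟨
      ∑[ i < suc j ] 1                        ≤⟨ ∑-mono-≤ targets-conflict ⟩
      ∑[ i < suc j ] conflictsAtv₀ (targets i) ≤⟨ ∑-inject-≤ conflictsAtv₀ targets targets-injective ⟩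
      ∑[ g < N ] conflictsAtv₀ g              ≡⟨ sum-map-allFin conflictsAtv₀ ⟨
      degφ badCover φ (enc v₀)                ≤⟨ proj₂ (φ-col (enc v₀)) v₀-rich ⟩
      j                                       ∎)
      where open ≤-Reasoning

  badCover-uncolourable : 1 ≤ m → ¬ Has0jColoring j badCover
  badCover-uncolourable 1≤m (φ , φ-col) = NoColouring.absurd 1≤m φ φ-col

module DeficientColouring (m j : ℕ) (C : TwoFoldCover (G m j)) where

  open import Data.Nat using (zero; suc; _+_; _≤_; _<_; z≤n; s≤s; _≡ᵇ_)
  open import Data.Nat.Properties
  open import Data.Fin as F using (Fin; toℕ)
  open import Data.Fin.Patterns using (0F)
  import Data.Fin.Properties as FinP
  open import Data.Bool using (Bool; true; false; if_then_else_)
  open import Data.Bool.Properties using (¬-not)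
  open import Data.List using (_++_; map; allFin)
  open import Data.List.Properties using (map-∘; map-++; map-cong)
  open import Data.List.Membership.Propositional using (_∈_)
  open import Data.List.Membership.Propositional.Properties using (∈-map⁺)
  import Data.Nat.ListAction as List
  open import Data.Nat.ListAction.Properties using (sum-++)
  open import Data.Product using (Σ; _×_; _,_; proj₁; proj₂)
  open import Data.Sum using (_⊎_; inj₁; inj₂; [_,_]′)
  open import Function using (_∘_)
  open import Relation.Nullary using (Dec; yes; no; contradiction)
  open import Relation.Binary.PropositionalEquality
  open Gm m j

  ℓ : V → V → Link
  ℓ x y = link C (enc x) (enc y)

  adj-enc : ∀ {x y} → x ≢ y → ∀ s t → adj C (enc x , s) (enc y , t) ≡ conflicts (ℓ x y) s t
  adj-enc x≢y = adj≡conflicts C (enc-≢ x≢y)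

  size-ℓ≤edges : ∀ {x y} → x ≢ y → size (ℓ x y) ≤ edges x y
  size-ℓ≤edges x≢y = ≤-trans (size-link≤mult C (enc-≢ x≢y)) (≤-reflexive (multG-enc x≢y))

  ℓ-sym : ∀ {x y} → x ≢ y → ℓ x y ≡ ℓ y x
  ℓ-sym x≢y = link-sym C (enc-≢ x≢y)

  ℓ-simple : ∀ {x y} → x ≢ y → edges x y ≡ 1 → ℓ x y ≢ both
  ℓ-simple x≢y e≡1 = size<2⇒≢both (s≤s (≤-trans (size-ℓ≤edges x≢y) (≤-reflexive e≡1)))

  clash : (V → Bool) → V → V → ℕ
  clash ψ x y = b2n (adj C (enc x , ψ x) (enc y , ψ y))

  clash-sym : ∀ ψ x y → clash ψ x y ≡ clash ψ y x
  clash-sym ψ x y = cong b2n (adj-sym C (enc x , ψ x) (enc y , ψ y))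

  clash-ℓ : ∀ ψ x y → x ≢ y → clash ψ x y ≡ b2n (conflicts (ℓ x y) (ψ x) (ψ y))
  clash-ℓ ψ x y x≢y = cong b2n (adj-enc x≢y (ψ x) (ψ y))

  neighbourClashes : (V → Bool) → V → ℕ
  neighbourClashes ψ x = List.sum (map (clash ψ x) (neighbours x))

  adj⇒neighbour : ∀ (φ : Fin N → Bool) x g → adj C (enc x , φ (enc x)) (g , φ g) ≡ true →
                  g ∈ map enc (neighbours x)
  adj⇒neighbour φ x g adj≡true =
    subst (_∈ map enc (neighbours x)) (enc-dec g) (∈-map⁺ enc (edges≢0⇒∈neighbours x (dec g) edges≢0))
    where
    x≢g : enc x ≢ g
    x≢g refl = contradiction (trans (sym adj≡true) (adj-irr C (enc x , φ (enc x)))) λ ()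
    edges≢0 : edges x (dec g) ≢ 0
    edges≢0 = ≢-sym (<⇒≢ (≤-trans (adj⇒1≤mult C x≢g adj≡true) (≤-reflexive mult≡edges)))
      where
      mult≡edges : multG m j (enc x) g ≡ edges x (dec g)
      mult≡edges = trans (multG-≢ x≢g) (cong (λ z → edges z (dec g)) (dec-enc x))

  degree≤neighbourClashes : ∀ ψ x → degφ C (ψ ∘ dec) (enc x) ≤ neighbourClashes ψ x
  degree≤neighbourClashes ψ x = begin
    degφ C (ψ ∘ dec) (enc x)                            ≡⟨ sum-map-allFin conflictsAt ⟩
    ∑[ g < N ] conflictsAt g                            ≤⟨ ∑≤sum-map-support conflictsAt _ support ⟩
    List.sum (map conflictsAt (map enc (neighbours x))) ≡⟨ cong List.sum (map-∘ (neighbours x)) ⟨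
    List.sum (map (conflictsAt ∘ enc) (neighbours x))   ≡⟨ cong List.sum (map-cong at-enc (neighbours x)) ⟩
    neighbourClashes ψ x                                ∎
    where
    open ≤-Reasoning
    conflictsAt : Fin N → ℕ
    conflictsAt g = b2n (adj C (enc x , ψ (dec (enc x))) (g , ψ (dec g)))
    support : ∀ g → conflictsAt g ≢ 0 → g ∈ map enc (neighbours x)
    support g c≢0 = adj⇒neighbour (ψ ∘ dec) x g (¬-not {y = false} (c≢0 ∘ cong b2n))
    at-enc : ∀ y → conflictsAt (enc y) ≡ clash ψ x y
    at-enc y = cong₂ (λ a b → b2n (adj C (enc x , ψ a) (enc y , ψ b))) (dec-enc x) (dec-enc y)

  colouring : ∀ ψ → (∀ x → Permitted j (ψ x) (neighbourClashes ψ x)) → Has0jColoring j C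
  colouring ψ ok = ψ ∘ dec , λ g → subst (λ g → Good g) (enc-dec g) (good (dec g))
    where
    Good : Fin N → Set
    Good g = (ψ (dec g) ≡ false → degφ C (ψ ∘ dec) g ≡ 0) ×
             (ψ (dec g) ≡ true → degφ C (ψ ∘ dec) g ≤ j)
    good : ∀ x → Good (enc x)
    good x with Permitted-≤ (degree≤neighbourClashes ψ x) (ok x)
    ... | poor , ≤j = (λ p → poor (trans (sym (cong ψ (dec-enc x))) p)) , λ _ → ≤j

  onCycle : (Fin (suc m) → Bool) → V → Bool
  onCycle A (cyc a)   = A a
  onCycle A (tri _ _) = false

  cycleClash : (Fin (suc m) → Bool) → Fin (suc m) → Fin (suc m) → ℕ
  cycleClash A a b = clash (onCycle A) (cyc a) (cyc b)

  cycleClashes : (Fin (suc m) → Bool) → Fin (suc m) → ℕ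
  cycleClashes A a = cycleClash A a (next a) + (if m ≡ᵇ 1 then 0 else cycleClash A a (prev a))

  kxy kyu kux kuv : Fin j → Link
  kxy h = ℓ (X h) (Y h)
  kyu h = ℓ (Y h) (U h)
  kux h = ℓ (U h) (X h)
  kuv h = ℓ (U h) v₀

  record CyclePlan (c : ℕ) (b₀ : Bool) : Set where
    field
      cycleState : Fin (suc m) → Bool
      start      : cycleState 0F ≡ b₀
      cycle-ok   : ∀ a → a ≢ 0F → Permitted 1 (cycleState a) (cycleClashes cycleState a)
      start-ok   : cycleClashes cycleState 0F ≤ c

  CyclePlan-≤ : ∀ {c c′ b₀} → c ≤ c′ → CyclePlan c b₀ → CyclePlan c′ b₀
  CyclePlan-≤ c≤c′ P = record
    { cycleState = cycleState ; start = start ; cycle-ok = cycle-ok ; start-ok = ≤-trans start-ok c≤c′ }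
    where open CyclePlan P

  tipClashes : (b₀ : Bool) (u : Fin j → Bool) → ℕ
  tipClashes b₀ u = ∑[ h < j ] b2n (conflicts (kuv h) (u h) b₀)

  record Plan : Set where
    field
      b₀        : Bool
      c         : ℕ
      cyclePlan : CyclePlan c b₀
      limit     : Fin j → ℕ
      limit≤j   : ∀ h → limit h ≤ j
      triangle  : ∀ h → TriangleStates (limit h) (kxy h) (kyu h) (kux h) (kuv h) b₀
      v₀-ok     : Permitted j b₀ (c + tipClashes b₀ (TriangleStates.u ∘ triangle))

  module PlanColouring (1≤j : 1 ≤ j) (P : Plan) where
    open Plan P
    open CyclePlan cyclePlan

    state : V → Bool
    state (cyc a) = cycleState a
    state (X h)   = TriangleStates.x (triangle h)
    state (Y h)   = TriangleStates.y (triangle h)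
    state (U h)   = TriangleStates.u (triangle h)

    sum-cycleNeighbours : ∀ a →
                          List.sum (map (clash state (cyc a)) (cycleNeighbours a)) ≡ cycleClashes cycleState a
    sum-cycleNeighbours a with m ≡ᵇ 1
    ... | true  = refl
    ... | false = cong (cycleClash cycleState a (next a) +_) (+-identityʳ _)

    tip-clash : ∀ h → clash state (U h) v₀ ≡ b2n (conflicts (kuv h) (state (U h)) b₀)
    tip-clash h = trans (clash-ℓ state (U h) v₀ (λ ())) (cong (b2n ∘ conflicts (kuv h) (state (U h))) start)

    sum-tips : List.sum (map (clash state v₀) tips) ≡ tipClashes b₀ (TriangleStates.u ∘ triangle)
    sum-tips = begin
      List.sum (map (clash state v₀) (map U (allFin j)))  ≡⟨ cong List.sum (map-∘ (allFin j)) ⟨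
      List.sum (map (clash state v₀ ∘ U) (allFin j))       ≡⟨ sum-map-allFin (clash state v₀ ∘ U) ⟩
      ∑[ h < j ] clash state v₀ (U h)                      ≡⟨ sum-cong-≗ (λ h → trans (clash-sym state v₀ (U h))
                                                                                        (tip-clash h)) ⟩
      tipClashes b₀ (TriangleStates.u ∘ triangle)          ∎
      where open ≡-Reasoning

    v₀-clashes : neighbourClashes state v₀ ≤ c + tipClashes b₀ (TriangleStates.u ∘ triangle)
    v₀-clashes = begin
      List.sum (map f (cycleNeighbours 0F ++ tips))
        ≡⟨ cong List.sum (map-++ f (cycleNeighbours 0F) tips) ⟩
      List.sum (map f (cycleNeighbours 0F) ++ map f tips)
        ≡⟨ sum-++ (map f (cycleNeighbours 0F)) (map f tips) ⟩
      List.sum (map f (cycleNeighbours 0F)) + List.sum (map f tips)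
        ≡⟨ cong₂ _+_ (sum-cycleNeighbours 0F) sum-tips ⟩
      cycleClashes cycleState 0F + tipClashes b₀ (TriangleStates.u ∘ triangle)
        ≤⟨ +-monoˡ-≤ _ start-ok ⟩
      c + tipClashes b₀ (TriangleStates.u ∘ triangle)
        ∎
      where
      open ≤-Reasoning
      f = clash state v₀

    triangle-ok : ∀ h x {d} → Permitted (limit h) (state x) d → d ≡ neighbourClashes state x →
                  Permitted j (state x) (neighbourClashes state x)
    triangle-ok h x ok refl = Permitted-lim (limit≤j h) ok

    state-ok : ∀ x → Permitted j (state x) (neighbourClashes state x)
    state-ok (cyc 0F) =
      subst (λ b → Permitted j b (neighbourClashes state v₀)) (sym start) (Permitted-≤ v₀-clashes v₀-ok)
    state-ok (cyc (F.suc a)) = Permitted-lim 1≤j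
      (subst (Permitted 1 (cycleState (F.suc a))) (sym (sum-cycleNeighbours (F.suc a))) (cycle-ok (F.suc a) λ ()))
    state-ok (X h) = triangle-ok h (X h) (TriangleStates.x-ok (triangle h)) (sym
      (cong₂ _+_ (clash-ℓ state (X h) (Y h) (λ ()))
                 (trans (+-identityʳ _) (trans (clash-sym state (X h) (U h)) (clash-ℓ state (U h) (X h) (λ ()))))))
    state-ok (Y h) = triangle-ok h (Y h) (TriangleStates.y-ok (triangle h)) (sym
      (cong₂ _+_ (trans (clash-sym state (Y h) (X h)) (clash-ℓ state (X h) (Y h) (λ ())))
                 (trans (+-identityʳ _) (clash-ℓ state (Y h) (U h) (λ ())))))
    state-ok (U h) = triangle-ok h (U h) (TriangleStates.u-ok (triangle h)) (sym
      (cong₂ _+_ (clash-ℓ state (U h) (X h) (λ ()))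
                 (cong₂ _+_ (trans (clash-sym state (U h) (Y h)) (clash-ℓ state (Y h) (U h) (λ ())))
                            (trans (+-identityʳ _) (tip-clash h)))))

    plan-colouring : Has0jColoring j C
    plan-colouring = colouring state state-ok

  module LongCycle (2≤m : 2 ≤ m) where

    private
      1≤m : 1 ≤ m
      1≤m = ≤-trans (s≤s z≤n) 2≤m

    K : ℕ → Link
    K i = ℓ (cyc (pos i)) (cyc (pos (suc i)))

    K-simple : ∀ {i} → i ≤ m → K i ≢ both
    K-simple {i} i≤m = subst (λ b → ℓ (cyc (pos i)) (cyc b) ≢ both) (next-pos i≤m)
                             (ℓ-simple (cyc≢next 1≤m (pos i)) (edges-next 2≤m (pos i)))

    K-toℕ : ∀ a → K (toℕ a) ≡ ℓ (cyc a) (cyc (next a))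
    K-toℕ a = cong (λ b → ℓ (cyc b) (cyc (next a))) (pos-toℕ a)

    open CycleColouring m K K-simple public

    module _ {c b₀} (S : CycleStates c b₀) where
      open CycleStates S

      A : Fin (suc m) → Bool
      A = state ∘ toℕ

      A-next : ∀ a → A (next a) ≡ state (suc (toℕ a))
      A-next a with place a
      ... | inner a<m = cong state (toℕ-next-inner a<m)
      ... | last  a≡m = trans (cong state (toℕ-next-last a≡m))
                              (trans state-start (trans (sym state-end) (cong (state ∘ suc) (sym a≡m))))

      clash-next : ∀ a → cycleClash A a (next a) ≡ Conflict state (toℕ a)
      clash-next a = trans (clash-ℓ (onCycle A) (cyc a) (cyc (next a)) (cyc≢next 1≤m a))
                           (cong₂ (λ K′ b → b2n (conflicts K′ (A a) b)) (sym (K-toℕ a)) (A-next a))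

      clash-prev : ∀ a → cycleClash A a (prev a) ≡ Conflict state (toℕ (prev a))
      clash-prev a = begin
        cycleClash A a (prev a)                ≡⟨ cong b2n (adj-sym C _ _) ⟩
        cycleClash A (prev a) a                ≡⟨ cong (cycleClash A (prev a)) (sym (next-prev a)) ⟩
        cycleClash A (prev a) (next (prev a))  ≡⟨ clash-next (prev a) ⟩
        Conflict state (toℕ (prev a))          ∎
        where open ≡-Reasoning

      cycleClashes≡ : ∀ a → cycleClashes A a ≡ Conflict state (toℕ a) + Conflict state (toℕ (prev a))
      cycleClashes≡ a rewrite ≡ᵇ-false {m} {1} (<⇒≢ 2≤m ∘ sym) = cong₂ _+_ (clash-next a) (clash-prev a)

      longCyclePlan : CyclePlan c b₀
      longCyclePlan = record
        { cycleState = A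
        ; start      = state-start
        ; cycle-ok   = ok
        ; start-ok   = subst (_≤ c) (sym clashes₀≡) start-ok
        }
        where
        clashes₀≡ : cycleClashes A 0F ≡ Conflict state 0 + Conflict state m
        clashes₀≡ = trans (cycleClashes≡ 0F) (cong (λ i → Conflict state 0 + Conflict state i) (toℕ-prev-zero refl))

        ok : ∀ a → a ≢ 0F → Permitted 1 (A a) (cycleClashes A a)
        ok a a≢0 = by-toℕ (toℕ a) refl
          where
          by-toℕ : ∀ k → toℕ a ≡ k → Permitted 1 (A a) (cycleClashes A a)
          by-toℕ zero    a≡0   = contradiction (FinP.toℕ-injective a≡0) a≢0
          by-toℕ (suc i) a≡1+i = subst₂ (Permitted 1) (cong state (sym a≡1+i)) (sym clashes≡)
                                        (inner-ok i (subst (_≤ m) a≡1+i (toℕ≤m a)))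
            where
            clashes≡ : cycleClashes A a ≡ Conflict state i + Conflict state (suc i)
            clashes≡ = trans (cycleClashes≡ a)
                         (trans (cong₂ (λ k l → Conflict state k + Conflict state l) a≡1+i (toℕ-prev-suc a≡1+i))
                                (+-comm (Conflict state (suc i)) (Conflict state i)))

  module ShortCycle (m≡1 : m ≡ 1) where

    private
      1≤m : 1 ≤ m
      1≤m = ≤-reflexive (sym m≡1)

    v₁ : Fin (suc m)
    v₁ = next 0F

    v₁≢0 : v₁ ≢ 0F
    v₁≢0 = cyc≢next 1≤m 0F ∘ cong cyc ∘ sym

    k : Link
    k = ℓ v₀ (cyc v₁)

    -- v₁ is poor unless a poor v₁ would clash with v₀
    partner : Bool → Bool
    partner b = conflicts k b false

    partner-free : ∀ {K} → K ≢ both → ∀ b → conflicts K b (conflicts K b false) ≡ false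
    partner-free {none}     _ b     = refl
    partner-free {straight} _ true  = refl
    partner-free {straight} _ false = refl
    partner-free {crossed}  _ true  = refl
    partner-free {crossed}  _ false = refl
    partner-free {both}     simple _ = contradiction refl simple

    partner-ok : ∀ b → Permitted 1 (partner b) (b2n (conflicts k b (partner b)))
    partner-ok b = (λ poor → cong b2n (trans (cong (conflicts k b) poor) poor)) , b2n≤1 _

    states : Bool → Fin (suc m) → Bool
    states b 0F        = b
    states b (F.suc _) = partner b

    only-v₁ : ∀ a → a ≢ 0F → a ≡ v₁
    only-v₁ a a≢0 = FinP.toℕ-injective (trans toℕa≡1 (sym (toℕ-next-inner {0F} 1≤m)))
      where
      toℕa≡1 : toℕ a ≡ 1
      toℕa≡1 = ≤-antisym (≤-trans (toℕ≤m a) (≤-reflexive m≡1))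
                         (n≢0⇒n>0 (a≢0 ∘ FinP.toℕ-injective {j = 0F}))

    edge≡k : ∀ a → ℓ (cyc a) (cyc (next a)) ≡ k
    edge≡k 0F        = refl
    edge≡k (F.suc i) = begin
      ℓ (cyc (F.suc i)) (cyc (next (F.suc i))) ≡⟨ cong (λ b → ℓ (cyc b) (cyc (next b))) (only-v₁ _ (λ ())) ⟩
      ℓ (cyc v₁) (cyc (next v₁))               ≡⟨ cong (ℓ (cyc v₁) ∘ cyc) (next-next m≡1 0F) ⟩
      ℓ (cyc v₁) v₀                            ≡⟨ ℓ-sym (cyc≢next 1≤m 0F ∘ sym) ⟩
      k                                        ∎
      where open ≡-Reasoning

    states-nonzero : ∀ b a → a ≢ 0F → states b a ≡ partner b
    states-nonzero b 0F        a≢0 = contradiction refl a≢0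
    states-nonzero b (F.suc _) _   = refl

    states-v₁ : ∀ b → states b v₁ ≡ partner b
    states-v₁ b = states-nonzero b v₁ v₁≢0

    clash-v₀v₁ : ∀ b → cycleClash (states b) 0F v₁ ≡ b2n (conflicts k b (partner b))
    clash-v₀v₁ b = trans (clash-ℓ (onCycle (states b)) v₀ (cyc v₁) (cyc≢next 1≤m 0F))
                         (cong (b2n ∘ conflicts k b) (states-v₁ b))

    cycleClashes≡ : ∀ b a → cycleClashes (states b) a ≡ b2n (conflicts k b (partner b))
    cycleClashes≡ b a rewrite ≡ᵇ-true m≡1 = trans (+-identityʳ _) (by-cases a)
      where
      by-cases : ∀ a → cycleClash (states b) a (next a) ≡ b2n (conflicts k b (partner b))
      by-cases 0F = clash-v₀v₁ b
      by-cases (F.suc i) = trans (cong (λ a → cycleClash (states b) a (next a)) (only-v₁ (F.suc i) (λ ()))) (begin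
        cycleClash (states b) v₁ (next v₁)  ≡⟨ cong (cycleClash (states b) v₁) (next-next m≡1 0F) ⟩
        cycleClash (states b) v₁ 0F         ≡⟨ cong b2n (adj-sym C _ _) ⟩
        cycleClash (states b) 0F v₁         ≡⟨ clash-v₀v₁ b ⟩
        b2n (conflicts k b (partner b))     ∎)
        where open ≡-Reasoning

    shortCyclePlan : ∀ b → CyclePlan (b2n (conflicts k b (partner b))) b
    shortCyclePlan b = record
      { cycleState = states b
      ; start      = refl
      ; cycle-ok   = λ a a≢0 → subst₂ (Permitted 1) (sym (states-nonzero b a a≢0)) (sym (cycleClashes≡ b a))
                                       (partner-ok b)
      ; start-ok   = ≤-reflexive (cycleClashes≡ b 0F)
      }

  richCycle : 1 ≤ m → CyclePlan 1 true
  richCycle 1≤m with m≤n⇒m<n∨m≡n 1≤m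
  ... | inj₁ 2≤m = LongCycle.longCyclePlan 2≤m (LongCycle.rich-cycle 2≤m 1≤m)
  ... | inj₂ 1≡m = CyclePlan-≤ (b2n≤1 _) (ShortCycle.shortCyclePlan (sym 1≡m) true)

  FreeCycle : Set
  FreeCycle = ∀ b₀ → CyclePlan 0 b₀

  TriangleDeficient : Fin j → Set
  TriangleDeficient h = kxy h ≡ none ⊎ kyu h ≡ none ⊎ kux h ≡ none ⊎ kuv h ≡ none

  Weakness : Set
  Weakness = FreeCycle ⊎ Σ (Fin j) TriangleDeficient

  DeficientPair : V → V → Set
  DeficientPair x y = size (ℓ x y) < edges x y

  deficient-sym : ∀ {x y} → x ≢ y → DeficientPair x y → DeficientPair y x
  deficient-sym {x} {y} x≢y = subst₂ _<_ (cong size (ℓ-sym x≢y)) (edges-sym x y)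

  simple-deficient : ∀ x y → edges x y ≡ 1 → DeficientPair x y → ℓ x y ≡ none
  simple-deficient x y e≡1 d = size<1⇒none (subst (size (ℓ x y) <_) e≡1 d)

  edge-weakness : 1 ≤ m → ∀ {x y} → Edge x y → DeficientPair x y → Weakness
  edge-weakness 1≤m (cycle a) d with m≤n⇒m<n∨m≡n 1≤m
  ... | inj₁ 2≤m = inj₁ λ b₀ → longCyclePlan (free-cycle (toℕ≤m a) K-none b₀)
    where
    open LongCycle 2≤m
    K-none : K (toℕ a) ≡ none
    K-none = trans (K-toℕ a) (simple-deficient (cyc a) (cyc (next a)) (edges-next 2≤m a) d)
  ... | inj₂ 1≡m = inj₁ λ b₀ →
    CyclePlan-≤ (≤-reflexive (cong b2n (partner-free k-simple b₀))) (shortCyclePlan b₀)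
    where
    open ShortCycle (sym 1≡m)
    edge-simple : ℓ (cyc a) (cyc (next a)) ≢ both
    edge-simple = size<2⇒≢both (≤-trans d (≤-reflexive (edges-next-1 (sym 1≡m) a)))
    k-simple : k ≢ both
    k-simple = subst (_≢ both) (edge≡k a) edge-simple
  edge-weakness _ (xy h) d = inj₂ (h , inj₁ (simple-deficient (X h) (Y h) (edges-xy h) d))
  edge-weakness _ (yu h) d = inj₂ (h , inj₂ (inj₁ (simple-deficient (Y h) (U h) (edges-yu h) d)))
  edge-weakness _ (ux h) d = inj₂ (h , inj₂ (inj₂ (inj₁ (simple-deficient (U h) (X h) (edges-ux h) d))))
  edge-weakness _ (uv h) d = inj₂ (h , inj₂ (inj₂ (inj₂ (simple-deficient (U h) v₀ (edges-uv h) d))))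

  deficient-pair : Deficient C → Σ V λ x → Σ V λ y → x ≢ y × DeficientPair x y
  deficient-pair (g , g′ , g≢g′ , d) = dec g , dec g′ , dec-≢ g≢g′ , subst₂ _<_ size≡ (multG-≢ g≢g′) d
    where
    size≡ : size (link C g g′) ≡ size (ℓ (dec g) (dec g′))
    size≡ = cong size (cong₂ (link C) (sym (enc-dec g)) (sym (enc-dec g′)))

  weakness : 1 ≤ m → Deficient C → Weakness
  weakness 1≤m D with deficient-pair D
  ... | x , y , x≢y , d with edges≢0⇒Edge x y (≢-sym (<⇒≢ (≤-trans (s≤s z≤n) d)))
  ...   | inj₁ e = edge-weakness 1≤m e d
  ...   | inj₂ e = edge-weakness 1≤m e (deficient-sym x≢y d)

  module _ (h : Fin j) where
    private
      s-xy = ℓ-simple {X h} {Y h} (λ ()) (edges-xy h)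
      s-yu = ℓ-simple {Y h} {U h} (λ ()) (edges-yu h)
      s-ux = ℓ-simple {U h} {X h} (λ ()) (edges-ux h)
      s-uv = ℓ-simple {U h} {v₀}  (λ ()) (edges-uv h)

    rich-triangle : TriangleStates 2 (kxy h) (kyu h) (kux h) (kuv h) true
    rich-triangle = triangle-rich s-xy s-yu s-ux s-uv

    deficient-triangle : TriangleDeficient h →
                         Σ (TriangleStates 1 (kxy h) (kyu h) (kux h) (kuv h) true) AvoidsV₀
    deficient-triangle = triangle-deficient s-xy s-yu s-ux s-uv

    single-triangle : Σ (TriangleStates 1 (kxy h) (kyu h) (kux h) (kuv h) false) AvoidsV₀ ⊎
                      TriangleStates 1 (kxy h) (kyu h) (kux h) (kuv h) true
    single-triangle = triangle-single s-xy s-yu s-ux s-uv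

  distinct⇒2≤ : ∀ {n} {a b : Fin n} → a ≢ b → 2 ≤ n
  distinct⇒2≤ {suc zero}    {0F} {0F} a≢b = contradiction refl a≢b
  distinct⇒2≤ {suc (suc n)} _             = s≤s (s≤s z≤n)

  singleton : ∀ {n} → 1 ≡ n → (a b : Fin n) → a ≡ b
  singleton refl 0F 0F = refl

  planFromTriangle : 1 ≤ m → 1 ≤ j → ∀ h₀ → TriangleDeficient h₀ → Plan
  planFromTriangle 1≤m 1≤j h₀ deficient = record
    { b₀ = true ; c = 1 ; cyclePlan = richCycle 1≤m
    ; limit    = λ h → proj₁ (choice h (h F.≟ h₀))
    ; limit≤j  = λ h → proj₁ (proj₂ (choice h (h F.≟ h₀)))
    ; triangle = λ h → proj₂ (proj₂ (choice h (h F.≟ h₀)))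
    ; v₀-ok    = (λ ()) , ∑-≤1-with-zero (λ _ → b2n≤1 _) h₀ tip₀≡0
    }
    where
    choice : ∀ h → Dec (h ≡ h₀) →
             Σ ℕ λ lim → lim ≤ j × TriangleStates lim (kxy h) (kyu h) (kux h) (kuv h) true
    choice h (yes refl) = 1 , 1≤j , proj₁ (deficient-triangle h₀ deficient)
    choice h (no h≢h₀)  = 2 , distinct⇒2≤ h≢h₀ , rich-triangle h

    tip₀≡0 : b2n (conflicts (kuv h₀) (TriangleStates.u (proj₂ (proj₂ (choice h₀ (h₀ F.≟ h₀))))) true) ≡ 0
    tip₀≡0 with h₀ F.≟ h₀
    ... | yes refl  = cong b2n (proj₂ (deficient-triangle h₀ deficient))
    ... | no h₀≢h₀ = contradiction refl h₀≢h₀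

  -- For j = 1 a rich vertex tolerates a single conflict, so the one triangle is coloured with limit 1
  -- and its colouring decides the state of v₀.
  module SingleTriangle (1≡j : 1 ≡ j) (free : FreeCycle) where

    h₀ : Fin j
    h₀ = subst Fin 1≡j 0F

    poorPlan : Σ (TriangleStates 1 (kxy h₀) (kyu h₀) (kux h₀) (kuv h₀) false) AvoidsV₀ → Plan
    poorPlan poor = record
      { b₀ = false ; c = 0 ; cyclePlan = free false
      ; limit = λ _ → 1 ; limit≤j = λ _ → ≤-reflexive 1≡j ; triangle = proj₁ ∘ everywhere
      ; v₀-ok = (λ _ → ∑-zero (cong b2n ∘ proj₂ ∘ everywhere)) , ∑-≤1 (λ _ → b2n≤1 _)
      }
      where
      everywhere : ∀ h → Σ (TriangleStates 1 (kxy h) (kyu h) (kux h) (kuv h) false) AvoidsV₀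
      everywhere h = subst (λ h → Σ (TriangleStates 1 (kxy h) (kyu h) (kux h) (kuv h) false) AvoidsV₀)
                           (singleton 1≡j h₀ h) poor

    richPlan : TriangleStates 1 (kxy h₀) (kyu h₀) (kux h₀) (kuv h₀) true → Plan
    richPlan rich = record
      { b₀ = true ; c = 0 ; cyclePlan = free true
      ; limit = λ _ → 1 ; limit≤j = λ _ → ≤-reflexive 1≡j ; triangle = everywhere
      ; v₀-ok = (λ ()) , ∑-≤1 (λ _ → b2n≤1 _)
      }
      where
      everywhere : ∀ h → TriangleStates 1 (kxy h) (kyu h) (kux h) (kuv h) true
      everywhere h = subst (λ h → TriangleStates 1 (kxy h) (kyu h) (kux h) (kuv h) true)
                           (singleton 1≡j h₀ h) rich

    plan : Plan
    plan = [ poorPlan , richPlan ]′ (single-triangle h₀)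

  planFromFreeCycle : 1 ≤ j → FreeCycle → Plan
  planFromFreeCycle 1≤j free with m≤n⇒m<n∨m≡n 1≤j
  ... | inj₁ 2≤j = record
    { b₀ = true ; c = 0 ; cyclePlan = free true
    ; limit = λ _ → 2 ; limit≤j = λ _ → 2≤j ; triangle = rich-triangle
    ; v₀-ok = (λ ()) , ∑-≤1 (λ _ → b2n≤1 _)
    }
  ... | inj₂ 1≡j = SingleTriangle.plan 1≡j free

  deficient-colourable : 1 ≤ m → 1 ≤ j → Deficient C → Has0jColoring j C
  deficient-colourable 1≤m 1≤j D with weakness 1≤m D
  ... | inj₁ free           = PlanColouring.plan-colouring 1≤j (planFromFreeCycle 1≤j free)
  ... | inj₂ (h , deficient) = PlanColouring.plan-colouring 1≤j (planFromTriangle 1≤m 1≤j h deficient)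

proposition10p5 : (j m : ℕ) → j ≥ 1 → m ≥ 1 → Is0jCritical j (G m j)
proposition10p5 j m 1≤j 1≤m =
  (badCover , badCover-uncolourable 1≤m) ,
  λ H S proper C → let open Extension S C in
    restrict j (deficient-colourable m j extension 1≤m 1≤j (proper⇒deficient (nonisolated 1≤m) proper))
  where
  open Gm m j using (nonisolated)
  open Uncolourable m j using (badCover; badCover-uncolourable)
  open DeficientColouring using (deficient-colourable)
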